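{- For $m\ge1$, $n\in\mathbb N$ and $k\in\mathbb Z$ we have $S[m,0,k]=\delta_{k,0}$ and, for $n\ge1$, $$S[m,n,k]=S[m,n-1,k-1]+[km+1]_q\,S[m,n-1,k].$$
   Context: $[j]_q=1+q+\dots+q^{j-1}$ (so $[j]_q=0$ for $j\le0$). Let $\zeta_m=e^{2\pi i/m}$, $\mathbf e_i$ the standard basis vectors of $\mathbb C^n$, $i^c=\zeta_m^c\mathbf e_i$ (base $i$, color $c$ mod $m$), $[n^m]=\{0\}\cup\{i^c:i\in[n],0\le c<m\}$, and $zS=\{zs:s\in S\}$. A colored set partition of type $(m,n)$ is a set partition of $[n^m]$ into blocks $S_0,\dots,S_{km}$ with (i) $0\in S_0$ and if some $i^c\in S_0$ then all $i^d\in S_0$; (ii) for each $0\le l<k$, $S_{lm+1},\dots,S_{(l+1)m}$ are distinct and of the form $S,\zeta_mS,\dots,\zeta_m^{m-1}S$. For nonempty $S\subseteq[n^m]$, $\operatorname{minb}S=0$ if $0\in S$ and otherwise the least base $i$ with some $i^c\in S$. Such a partition is in standard form if its blocks are labeled so that condition (ii) holds, $s_i:=\operatorname{minb}S_i$ satisfy $0=s_0<s_m<s_{2m}<\dots<s_{km}$, and for each $j\in[km]$ we have $s_j^{\,r}\in S_j$ where $r$ is the remainder of $j$ modulo $m$; the standard form exists and is unique. An inversion of a partition in standard form is a pair $(i^0,S_l)$ with $i^0\in S_j$ for some $j<l$ and $i\ge s_l$; $\operatorname{inv}$ is the number of inversions. $S[m,n,k]=\sum q^{\operatorname{inv}\sigma}$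 over all type $(m,n)$ colored set partitions $\sigma$ of $[n^m]$ with $km+1$ blocks (zero if there are none). -}

module Defs where

open import Data.Nat using (ℕ; NonZero; _<ᵇ_ ; zero; suc; _+_; _*_; _∸_; _≡ᵇ_)
open import Data.Nat.DivMod using (_%_)
open import Data.Integer using (ℤ; +_; -[1+_])
open import Data.Fin using (Fin; toℕ)
open import Data.List using (List; []; _∷_; map; concatMap; filter; length; upTo; foldr; allFin)
open import Data.Bool.ListAction using (any; all)
open import Data.Vec.Functional as VF using ()
open import Data.Bool using (Bool; true; false; _∧_; _∨_; not; if_then_else_)
open import Data.Bool.Properties using (T?)
open import Relation.Binary.PropositionalEquality using (_≡_)

-- Polynomials in q with ℕ coefficients, as coefficient sequences.
-- (p d) is the coefficient of q^d.  Equality is coefficientwise.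

Poly : Set
Poly = ℕ → ℕ

_≈ₚ_ : Poly → Poly → Set
p ≈ₚ r = ∀ d → p d ≡ r d

infix 4 _≈ₚ_

zeroₚ : Poly
zeroₚ _ = 0

oneₚ : Poly
oneₚ d = if d ≡ᵇ 0 then 1 else 0

_⊕_ : Poly → Poly → Poly
(p ⊕ r) d = p d + r d

infixl 6 _⊕_

sumTo : ℕ → (ℕ → ℕ) → ℕ
sumTo zero    f = f 0
sumTo (suc d) f = sumTo d f + f (suc d)

_⊛_ : Poly → Poly → Poly
(p ⊛ r) d = sumTo d (λ i → p i * r (d ∸ i))

infixl 7 _⊛_

-- q-integer [j]_q = 1 + q + ... + q^(j-1), zero for j ≤ 0
qint : ℤ → Poly
qint (+ j)    d = if d <ᵇ j then 1 else 0
qint -[1+ _ ] d = 0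

δ₀ : ℤ → Poly
δ₀ (+ zero)  = oneₚ
δ₀ (+ suc _) = zeroₚ
δ₀ -[1+ _ ]  = zeroₚ

allFuns : ∀ {A : Set} → List A → (a : ℕ) → List (Fin a → A)
allFuns xs zero    = (λ ()) ∷ []
allFuns xs (suc a) = concatMap (λ f → map (λ x → x VF.∷ f) xs) (allFuns xs a)

count : ∀ {A : Set} → (A → Bool) → List A → ℕ
count P xs = length (filter (λ x → T? (P x)) xs)

range1 : ℕ → List ℕ
range1 h = map suc (upTo h)

-- Colored set partitions of type (m,n) of [n^m] into km+1 blocks, in
-- standard form.  Points i^c (base i ∈ [n], color c ∈ {0..m-1}) are
-- indexed by (i : Fin n, c : Fin m) with base number  suc (toℕ i).
-- The point 0 always lies in S_0 (condition (i)).  A partition in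
-- standard form S_0,…,S_{km} is recorded by its labelling
--   L : Fin n → Fin m → Fin (k*m+1),   L i c = j  iff  i^c ∈ S_j.
-- Since the standard form exists and is unique, colored set partitions
-- with km+1 blocks correspond bijectively to labellings satisfying
-- `isStd` below.

module Partition (m : ℕ) {{_ : NonZero m}} (n k : ℕ) where

  B : ℕ
  B = k * m + 1

  Lab : Set
  Lab = Fin n → Fin m → Fin B

  bases : List (Fin n)
  bases = allFin n

  colors : List (Fin m)
  colors = allFin m

  base : Fin n → ℕ
  base i = suc (toℕ i)

  _⇔ᵇ_ : Bool → Bool → Bool
  true  ⇔ᵇ b = b
  false ⇔ᵇ b = not b

  module _ (L : Lab) where

    mem : Fin n → Fin m → ℕ → Bool
    mem i c j = toℕ (L i c) ≡ᵇ j

    baseIn : Fin n → ℕ → Bool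
    baseIn i j = any (λ c → mem i c j) colors

    -- every block S_1..S_{km} is nonempty (S_0 ∋ 0 always)
    nonempty : Bool
    nonempty = all (λ j → any (λ i → baseIn i j) bases) (range1 (k * m))

    condI : Bool
    condI = all (λ i → all (λ c → all (λ d → not (mem i c 0) ∨ mem i d 0) colors) colors) bases

    -- condition (ii): for 0 ≤ l < k and 0 ≤ t < m,  S_{lm+1+t} = ζ_m^t S_{lm+1},
    -- i.e. for all i, c', c with c ≡ c' + t (mod m):
    --   i^c ∈ S_{lm+1+t}  iff  i^{c'} ∈ S_{lm+1}.
    -- (Distinctness of these blocks is automatic: blocks of a set
    -- partition are pairwise disjoint and nonempty.)
    condII : Bool
    condII = all (λ l → all (λ t → all (λ i → all (λ c → all (λ c' →
               not (((toℕ c' + t) % m) ≡ᵇ toℕ c)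
               ∨ (mem i c (l * m + 1 + t) ⇔ᵇ mem i c' (l * m + 1)))
               colors) colors) bases) (upTo m)) (upTo k)

    -- minb S_j for j ≥ 1: least base i with some i^c ∈ S_j (0 if empty,
    -- which does not occur under `nonempty`);  minb S_0 = 0.
    minb : ℕ → ℕ
    minb zero    = 0
    minb (suc j) = foldr (λ i rest → if baseIn i (suc j) then base i else rest) 0 bases

    ordered : Bool
    ordered = all (λ l → minb (l * m) <ᵇ minb (suc l * m)) (upTo k)

    colorCond : Bool
    colorCond = all (λ j → any (λ i → any (λ c →
                  (base i ≡ᵇ minb j) ∧ (toℕ c ≡ᵇ (j % m)) ∧ mem i c j) colors) bases)
                  (range1 (k * m))

    isStd : Bool
    isStd = nonempty ∧ condI ∧ condII ∧ ordered ∧ colorCond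

    inv : ℕ
    inv = length (filter (λ p → T? p)
            (concatMap (λ i → concatMap (λ c → map (λ l →
               (toℕ c ≡ᵇ 0) ∧ (toℕ (L i c) <ᵇ l) ∧ not (base i <ᵇ minb l))
               (range1 (k * m))) colors) bases))

  allLabs : List Lab
  allLabs = allFuns (allFuns (allFin B) m) n

  Scoeff : Poly
  Scoeff d = count (λ L → isStd L ∧ (inv L ≡ᵇ d)) allLabs

-- S[m,n,k] = Σ_σ q^{inv σ}, for k ∈ ℤ (zero when there are no such partitions,
-- in particular for k < 0).
S[_,_,_] : (m : ℕ) → {{NonZero m}} → ℕ → ℤ → Poly
S[ m , n , + k ]    = Partition.Scoeff m n k
S[ m , n , -[1+ _ ] ] = zeroₚ

module Submission where

-- Split off the largest base n+1.  Its colour-0 point lies in some block S_j, and condition (ii)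
-- then fixes the blocks of all its other colours (the row `canonical j`).  Either the other bases
-- still form a standard partition with all km+1 blocks: then every j ∈ {0,…,km} occurs, and base
-- n+1, being the largest base, adds exactly one inversion with each block S_l, l > j, i.e. km − j
-- of them, which gives [km+1]_q S[m,n,k].  Or base n+1 alone fills the last group of m blocks:
-- then j = km, no inversion is added, and the rest is standard with (k−1)m+1 blocks, which gives
-- S[m,n,k−1].

open import Data.Nat using (ℕ)

module FiniteSums where

  open import Data.Nat using (ℕ; zero; suc; _+_; _*_; _∸_; _≤_; _<_; z≤n; s≤s; _<ᵇ_; _≡ᵇ_; _<?_; _≤?_; _⊓_)
  open import Data.Nat.Properties
  open import Algebra.Properties.CommutativeSemigroup +-commutativeSemigroup using (interchange)
  open import Data.Fin using (Fin; toℕ; fromℕ; inject₁; inject≤)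
  open import Data.Vec.Functional as Vec using ()
  open import Data.List using (List; []; _∷_; map; concatMap; concat; _++_; foldr; tabulate; allFin; upTo; applyUpTo)
  open import Data.List.Properties using (map-cong; map-tabulate; foldr-map)
  open import Data.List.Relation.Unary.All as All using (All; []; _∷_)
  open import Data.List.Relation.Unary.All.Properties as All using (all⁺; all⁻)
  open import Data.List.Relation.Unary.Any using (Any; here; there)
  open import Data.List.Relation.Unary.Any.Properties as Any using (any⁺; any⁻)
  open import Data.Bool using (Bool; true; false; T; _∧_; _∨_; not; if_then_else_)
  open import Data.Bool.Properties using (T-≡)
  open import Data.Bool.ListAction using (all; any; and; or)
  open import Data.Product using (∃; _×_; _,_; proj₁; proj₂)
  open import Function using (_∘_; id; _⇔_; mk⇔; Equivalence)
  open import Relation.Binary.PropositionalEquality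
  open import Relation.Nullary using (¬_; yes; no; contradiction)
  open import Defs using (count; allFuns; sumTo; range1)

  private
    variable
      A B : Set

  -- Boolean tests are handled as equations b ≡ true rather than as T b: unlike T, the
  -- equation determines b, which lets Agda infer the predicates in nested quantifiers.

  true⁻ : ∀ {b} → b ≡ true → T b
  true⁻ = Equivalence.from T-≡

  true⁺ : ∀ {b} → T b → b ≡ true
  true⁺ = Equivalence.to T-≡

  false⁺ : ∀ {b} → ¬ T b → b ≡ false
  false⁺ {false} _  = refl
  false⁺ {true}  ¬t = contradiction _ ¬t

  true-injective : ∀ {a b} → (a ≡ true → b ≡ true) → (b ≡ true → a ≡ true) → a ≡ b
  true-injective {false} {false} _ _ = refl
  true-injective {false} {true}  _ g = g refl
  true-injective {true}  {false} f _ = sym (f refl)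
  true-injective {true}  {true}  _ _ = refl

  ∧-true⁻ : ∀ {a b} → a ∧ b ≡ true → a ≡ true × b ≡ true
  ∧-true⁻ {true} b≡ = refl , b≡

  ∧-true⁺ : ∀ {a b} → a ≡ true → b ≡ true → a ∧ b ≡ true
  ∧-true⁺ refl b≡ = b≡

  →-true⁻ : ∀ {a b} → not a ∨ b ≡ true → a ≡ true → b ≡ true
  →-true⁻ {true} h _ = h

  →-true⁺ : ∀ {a b} → (a ≡ true → b ≡ true) → not a ∨ b ≡ true
  →-true⁺ {true}  f = f refl
  →-true⁺ {false} f = refl

  ≡ᵇ-true⁻ : ∀ {x y} → (x ≡ᵇ y) ≡ true → x ≡ y
  ≡ᵇ-true⁻ {x} {y} = ≡ᵇ⇒≡ x y ∘ true⁻

  ≡ᵇ-true⁺ : ∀ {x y} → x ≡ y → (x ≡ᵇ y) ≡ true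
  ≡ᵇ-true⁺ {x} {y} = true⁺ ∘ ≡⇒≡ᵇ x y

  <ᵇ-true⁻ : ∀ {x y} → (x <ᵇ y) ≡ true → x < y
  <ᵇ-true⁻ {x} {y} = <ᵇ⇒< x y ∘ true⁻

  <ᵇ-true⁺ : ∀ {x y} → x < y → (x <ᵇ y) ≡ true
  <ᵇ-true⁺ = true⁺ ∘ <⇒<ᵇ

  <ᵇ-false⁺ : ∀ {x y} → ¬ x < y → (x <ᵇ y) ≡ false
  <ᵇ-false⁺ {x} {y} x≮y = false⁺ (x≮y ∘ <ᵇ⇒< x y)

  all-cong : ∀ {p q : A → Bool} → (∀ x → p x ≡ q x) → ∀ xs → all p xs ≡ all q xs
  all-cong p≗q xs = cong and (map-cong p≗q xs)

  any-cong : ∀ {p q : A → Bool} → (∀ x → p x ≡ q x) → ∀ xs → any p xs ≡ any q xs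
  any-cong p≗q xs = cong or (map-cong p≗q xs)

  ≡ᵇ-cong⁻ : ∀ {x y x′ y′} → (x ≡ᵇ y) ≡ (x′ ≡ᵇ y′) → (x ≡ y) ⇔ (x′ ≡ y′)
  ≡ᵇ-cong⁻ eq = mk⇔ (λ x≡y → ≡ᵇ-true⁻ (trans (sym eq) (≡ᵇ-true⁺ x≡y)))
                    (λ x′≡y′ → ≡ᵇ-true⁻ (trans eq (≡ᵇ-true⁺ x′≡y′)))

  ≡ᵇ-cong⁺ : ∀ {x y x′ y′} → (x ≡ y) ⇔ (x′ ≡ y′) → (x ≡ᵇ y) ≡ (x′ ≡ᵇ y′)
  ≡ᵇ-cong⁺ e = true-injective (≡ᵇ-true⁺ ∘ Equivalence.to e ∘ ≡ᵇ-true⁻)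
                              (≡ᵇ-true⁺ ∘ Equivalence.from e ∘ ≡ᵇ-true⁻)

  module _ {n} (p : Fin n → Bool) where

    all-allFin⁻ : all p (allFin n) ≡ true → ∀ i → p i ≡ true
    all-allFin⁻ h i = true⁺ (All.tabulate⁻ (all⁺ p _ (true⁻ h)) i)

    all-allFin⁺ : (∀ i → p i ≡ true) → all p (allFin n) ≡ true
    all-allFin⁺ h = true⁺ (all⁻ p (All.tabulate⁺ (true⁻ ∘ h)))

    any-allFin⁻ : any p (allFin n) ≡ true → ∃ λ i → p i ≡ true
    any-allFin⁻ h = let i , pi = Any.tabulate⁻ (any⁻ p _ (true⁻ h)) in i , true⁺ pi

    any-allFin⁺ : ∀ i → p i ≡ true → any p (allFin n) ≡ true
    any-allFin⁺ i h = true⁺ (any⁺ p (Any.tabulate⁺ i (true⁻ h)))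

  module _ (p : ℕ → Bool) where

    all-upTo⁻ : ∀ {K} → all p (upTo K) ≡ true → ∀ {l} → l < K → p l ≡ true
    all-upTo⁻ h l<K = true⁺ (All.applyUpTo⁻ id _ (all⁺ p _ (true⁻ h)) l<K)

    all-upTo⁺ : ∀ {K} → (∀ {l} → l < K → p l ≡ true) → all p (upTo K) ≡ true
    all-upTo⁺ h = true⁺ (all⁻ p (All.applyUpTo⁺₁ id _ (true⁻ ∘ h)))

    all-range1⁻ : ∀ {K} → all p (range1 K) ≡ true → ∀ {j} → j < K → p (suc j) ≡ true
    all-range1⁻ h j<K = true⁺ (All.applyUpTo⁻ id _ (All.map⁻ (all⁺ p _ (true⁻ h))) j<K)

    all-range1⁺ : ∀ {K} → (∀ {j} → j < K → p (suc j) ≡ true) → all p (range1 K) ≡ true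
    all-range1⁺ h = true⁺ (all⁻ p (All.map⁺ (All.applyUpTo⁺₁ id _ (true⁻ ∘ h))))

  allᵛ : ∀ {n} → (Fin n → Bool) → Bool
  allᵛ = Vec.foldr _∧_ true

  allᵛ⁻ : ∀ {n} (p : Fin n → Bool) → allᵛ p ≡ true → ∀ i → p i ≡ true
  allᵛ⁻ {suc n} p h Fin.zero    = proj₁ (∧-true⁻ h)
  allᵛ⁻ {suc n} p h (Fin.suc i) = allᵛ⁻ (p ∘ Fin.suc) (proj₂ (∧-true⁻ {p Fin.zero} h)) i

  allᵛ⁺ : ∀ {n} (p : Fin n → Bool) → (∀ i → p i ≡ true) → allᵛ p ≡ true
  allᵛ⁺ {zero}  p h = refl
  allᵛ⁺ {suc n} p h = ∧-true⁺ (h Fin.zero) (allᵛ⁺ (p ∘ Fin.suc) (h ∘ Fin.suc))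

  ⟦_⟧ : Bool → ℕ
  ⟦ true ⟧  = 1
  ⟦ false ⟧ = 0

  ⟦∧⟧ : ∀ a b → ⟦ a ∧ b ⟧ ≡ ⟦ a ⟧ * ⟦ b ⟧
  ⟦∧⟧ true  b = sym (*-identityˡ ⟦ b ⟧)
  ⟦∧⟧ false b = refl

  ⟦∧⟧-swap : ∀ a b c → ⟦ a ∧ b ∧ c ⟧ ≡ ⟦ b ⟧ * ⟦ a ∧ c ⟧
  ⟦∧⟧-swap true  b c = ⟦∧⟧ b c
  ⟦∧⟧-swap false b c = sym (*-zeroʳ ⟦ b ⟧)

  ⟦⟧≡if : ∀ b → ⟦ b ⟧ ≡ (if b then 1 else 0)
  ⟦⟧≡if true  = refl
  ⟦⟧≡if false = refl

  sumL : (A → ℕ) → List A → ℕ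
  sumL f []       = 0
  sumL f (x ∷ xs) = f x + sumL f xs

  infixr 6.5 sumL
  syntax sumL (λ x → e) xs = ∑[ x ← xs ] e

  count≡∑ : ∀ (P : A → Bool) xs → count P xs ≡ ∑[ x ← xs ] ⟦ P x ⟧
  count≡∑ P []       = refl
  count≡∑ P (x ∷ xs) with P x
  ... | true  = cong suc (count≡∑ P xs)
  ... | false = count≡∑ P xs

  sumL-cong : ∀ {f g : A → ℕ} → (∀ x → f x ≡ g x) → ∀ xs → sumL f xs ≡ sumL g xs
  sumL-cong f≗g []       = refl
  sumL-cong f≗g (x ∷ xs) = cong₂ _+_ (f≗g x) (sumL-cong f≗g xs)

  sumL-zero : ∀ {f : A → ℕ} → (∀ x → f x ≡ 0) → ∀ xs → sumL f xs ≡ 0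
  sumL-zero f≗0 []       = refl
  sumL-zero f≗0 (x ∷ xs) = cong₂ _+_ (f≗0 x) (sumL-zero f≗0 xs)

  sumL-++ : ∀ (f : A → ℕ) xs ys → sumL f (xs ++ ys) ≡ sumL f xs + sumL f ys
  sumL-++ f []       ys = refl
  sumL-++ f (x ∷ xs) ys = trans (cong (f x +_) (sumL-++ f xs ys)) (sym (+-assoc (f x) _ _))

  sumL-+ : ∀ (f g : A → ℕ) xs → ∑[ x ← xs ] (f x + g x) ≡ sumL f xs + sumL g xs
  sumL-+ f g []       = refl
  sumL-+ f g (x ∷ xs) = trans (cong (f x + g x +_) (sumL-+ f g xs))
                              (interchange (f x) (g x) (sumL f xs) (sumL g xs))

  sumL-*ˡ : ∀ a (f : A → ℕ) xs → ∑[ x ← xs ] (a * f x) ≡ a * sumL f xs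
  sumL-*ˡ a f []       = sym (*-zeroʳ a)
  sumL-*ˡ a f (x ∷ xs) = trans (cong (a * f x +_) (sumL-*ˡ a f xs)) (sym (*-distribˡ-+ a (f x) _))

  sumL-swap : ∀ (f : A → B → ℕ) xs ys →
              ∑[ x ← xs ] ∑[ y ← ys ] f x y ≡ ∑[ y ← ys ] ∑[ x ← xs ] f x y
  sumL-swap f []       ys = sym (sumL-zero (λ _ → refl) ys)
  sumL-swap f (x ∷ xs) ys = trans (cong (sumL (f x) ys +_) (sumL-swap f xs ys))
                                  (sym (sumL-+ (f x) (λ y → ∑[ x′ ← xs ] f x′ y) ys))

  sumL-map : ∀ (f : B → ℕ) (g : A → B) xs → sumL f (map g xs) ≡ sumL (f ∘ g) xs
  sumL-map f g []       = refl
  sumL-map f g (x ∷ xs) = cong (f (g x) +_) (sumL-map f g xs)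

  sumL-concatMap : ∀ (f : B → ℕ) (g : A → List B) xs →
                   sumL f (concatMap g xs) ≡ ∑[ x ← xs ] sumL f (g x)
  sumL-concatMap f g []       = refl
  sumL-concatMap f g (x ∷ xs) = trans (sumL-++ f (g x) (concat (map g xs)))
                                      (cong (sumL f (g x) +_) (sumL-concatMap f g xs))

  sumL-tabulate : ∀ {n} (f : A → ℕ) (g : Fin n → A) → sumL f (tabulate g) ≡ sumL (f ∘ g) (allFin n)
  sumL-tabulate {n = zero}  f g = refl
  sumL-tabulate {n = suc n} f g = cong (f (g Fin.zero) +_)
    (trans (sumL-tabulate f (g ∘ Fin.suc)) (sym (sumL-tabulate (f ∘ g) Fin.suc)))

  sumL-allFin-suc : ∀ {n} (f : Fin (suc n) → ℕ) →
                    sumL f (allFin (suc n)) ≡ f Fin.zero + sumL (f ∘ Fin.suc) (allFin n)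
  sumL-allFin-suc f = cong (f Fin.zero +_) (sumL-tabulate f Fin.suc)

  sumL-allFin-last : ∀ {n} (f : Fin (suc n) → ℕ) →
                     sumL f (allFin (suc n)) ≡ sumL (f ∘ inject₁) (allFin n) + f (fromℕ n)
  sumL-allFin-last {zero}  f = +-comm (f Fin.zero) 0
  sumL-allFin-last {suc n} f = begin
    sumL f (allFin (suc (suc n)))
      ≡⟨ sumL-allFin-suc f ⟩
    f Fin.zero + sumL (f ∘ Fin.suc) (allFin (suc n))
      ≡⟨ cong (f Fin.zero +_) (sumL-allFin-last (f ∘ Fin.suc)) ⟩
    f Fin.zero + (sumL (f ∘ Fin.suc ∘ inject₁) (allFin n) + f (fromℕ (suc n)))
      ≡⟨ sym (+-assoc (f Fin.zero) _ _) ⟩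
    f Fin.zero + sumL (f ∘ inject₁ ∘ Fin.suc) (allFin n) + f (fromℕ (suc n))
      ≡⟨ cong (_+ f (fromℕ (suc n))) (sym (sumL-allFin-suc (f ∘ inject₁))) ⟩
    sumL (f ∘ inject₁) (allFin (suc n)) + f (fromℕ (suc n))
      ∎
    where open ≡-Reasoning

  infixl 5 _∷ʳ_

  _∷ʳ_ : ∀ {n} → (Fin n → A) → A → Fin (suc n) → A
  _∷ʳ_ {n = zero}  f x _           = x
  _∷ʳ_ {n = suc n} f x Fin.zero    = f Fin.zero
  _∷ʳ_ {n = suc n} f x (Fin.suc i) = (f ∘ Fin.suc ∷ʳ x) i

  ∷ʳ-inject₁ : ∀ {n} (f : Fin n → A) x i → (f ∷ʳ x) (inject₁ i) ≡ f i
  ∷ʳ-inject₁ {n = suc n} f x Fin.zero    = refl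
  ∷ʳ-inject₁ {n = suc n} f x (Fin.suc i) = ∷ʳ-inject₁ (f ∘ Fin.suc) x i

  ∷ʳ-fromℕ : ∀ {n} (f : Fin n → A) x → (f ∷ʳ x) (fromℕ n) ≡ x
  ∷ʳ-fromℕ {n = zero}  f x = refl
  ∷ʳ-fromℕ {n = suc n} f x = ∷ʳ-fromℕ (f ∘ Fin.suc) x

  Respects≈ : ∀ {a} → (A → A → Set) → ((Fin a → A) → ℕ) → Set
  Respects≈ _≈_ F = ∀ f g → (∀ i → f i ≈ g i) → F f ≡ F g

  Respects≡ : ∀ {a} → ((Fin a → A) → ℕ) → Set
  Respects≡ = Respects≈ _≡_

  sumL-allFuns-suc : ∀ (xs : List A) a (F : (Fin (suc a) → A) → ℕ) →
    sumL F (allFuns xs (suc a)) ≡ ∑[ f ← allFuns xs a ] ∑[ x ← xs ] F (x Vec.∷ f)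
  sumL-allFuns-suc xs a F =
    trans (sumL-concatMap F _ (allFuns xs a)) (sumL-cong (λ f → sumL-map F _ xs) (allFuns xs a))

  sumL-allFuns-∷ʳ : ∀ (xs : List A) a (F : (Fin (suc a) → A) → ℕ) → Respects≡ F →
    sumL F (allFuns xs (suc a)) ≡ ∑[ g ← allFuns xs a ] ∑[ x ← xs ] F (g ∷ʳ x)
  sumL-allFuns-∷ʳ xs zero F resp =
    trans (sumL-allFuns-suc xs zero F) (cong (_+ 0) (sumL-cong (λ x → resp _ _ λ { Fin.zero → refl }) xs))
  sumL-allFuns-∷ʳ xs (suc a) F resp = begin
    sumL F (allFuns xs (suc (suc a)))
      ≡⟨ sumL-allFuns-suc xs (suc a) F ⟩
    ∑[ f ← allFuns xs (suc a) ] ∑[ x ← xs ] F (x Vec.∷ f)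
      ≡⟨ sumL-allFuns-∷ʳ xs a _ (λ f g f≗g → sumL-cong (λ x → resp _ _ (∷-cong x f≗g)) xs) ⟩
    ∑[ g ← allFuns xs a ] ∑[ y ← xs ] ∑[ x ← xs ] F (x Vec.∷ (g ∷ʳ y))
      ≡⟨ sumL-cong (λ g → sumL-swap (λ y x → F (x Vec.∷ (g ∷ʳ y))) xs xs) (allFuns xs a) ⟩
    ∑[ g ← allFuns xs a ] ∑[ x ← xs ] ∑[ y ← xs ] F (x Vec.∷ (g ∷ʳ y))
      ≡⟨ sumL-cong (λ g → sumL-cong (λ x → sumL-cong (λ y → resp _ _ (∷-∷ʳ x g y)) xs) xs) (allFuns xs a) ⟩
    ∑[ g ← allFuns xs a ] ∑[ x ← xs ] ∑[ y ← xs ] F ((x Vec.∷ g) ∷ʳ y)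
      ≡⟨ sym (sumL-allFuns-suc xs a (λ h → ∑[ y ← xs ] F (h ∷ʳ y))) ⟩
    ∑[ h ← allFuns xs (suc a) ] ∑[ y ← xs ] F (h ∷ʳ y)
      ∎
    where
    open ≡-Reasoning
    ∷-cong : ∀ x {f g : Fin (suc a) → A} → (∀ i → f i ≡ g i) → ∀ i → (x Vec.∷ f) i ≡ (x Vec.∷ g) i
    ∷-cong x f≗g Fin.zero    = refl
    ∷-cong x f≗g (Fin.suc i) = f≗g i
    ∷-∷ʳ : ∀ x (g : Fin a → A) y i → (x Vec.∷ (g ∷ʳ y)) i ≡ ((x Vec.∷ g) ∷ʳ y) i
    ∷-∷ʳ x g y Fin.zero    = refl
    ∷-∷ʳ x g y (Fin.suc i) = refl

  module _ (_≈_ : A → A → Set) (≈-refl : ∀ x → x ≈ x) (Q : A → Bool) (φ : B → A) where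

    sumL-allFuns-restrict : ∀ (xs : List A) (ys : List B) →
      (∀ h → (∀ x y → x ≈ y → h x ≡ h y) → ∑[ x ← xs ] ⟦ Q x ⟧ * h x ≡ ∑[ y ← ys ] h (φ y)) →
      ∀ a (H : (Fin a → A) → ℕ) → Respects≈ _≈_ H →
      ∑[ f ← allFuns xs a ] ⟦ allᵛ (Q ∘ f) ⟧ * H f ≡ ∑[ g ← allFuns ys a ] H (φ ∘ g)
    sumL-allFuns-restrict xs ys restrict zero    H resp = cong (_+ 0) (trans (+-identityʳ _) (resp _ _ λ ()))
    sumL-allFuns-restrict xs ys restrict (suc a) H resp = begin
      ∑[ f ← allFuns xs (suc a) ] ⟦ allᵛ (Q ∘ f) ⟧ * H f
        ≡⟨ sumL-allFuns-suc xs a _ ⟩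
      ∑[ f ← allFuns xs a ] ∑[ x ← xs ] ⟦ Q x ∧ allᵛ (Q ∘ f) ⟧ * H (x Vec.∷ f)
        ≡⟨ sumL-cong restrict-head (allFuns xs a) ⟩
      ∑[ f ← allFuns xs a ] ∑[ y ← ys ] ⟦ allᵛ (Q ∘ f) ⟧ * H (φ y Vec.∷ f)
        ≡⟨ sumL-swap (λ f y → ⟦ allᵛ (Q ∘ f) ⟧ * H (φ y Vec.∷ f)) (allFuns xs a) ys ⟩
      ∑[ y ← ys ] ∑[ f ← allFuns xs a ] ⟦ allᵛ (Q ∘ f) ⟧ * H (φ y Vec.∷ f)
        ≡⟨ sumL-cong (λ y → sumL-allFuns-restrict xs ys restrict a _ (resp-tail (φ y))) ys ⟩
      ∑[ y ← ys ] ∑[ g ← allFuns ys a ] H (φ y Vec.∷ (φ ∘ g))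
        ≡⟨ sym (sumL-swap (λ g y → H (φ y Vec.∷ (φ ∘ g))) (allFuns ys a) ys) ⟩
      ∑[ g ← allFuns ys a ] ∑[ y ← ys ] H (φ y Vec.∷ (φ ∘ g))
        ≡⟨ sumL-cong (λ g → sumL-cong (λ y → resp _ _ (∷-∘ y g)) ys) (allFuns ys a) ⟩
      ∑[ g ← allFuns ys a ] ∑[ y ← ys ] H (φ ∘ (y Vec.∷ g))
        ≡⟨ sym (sumL-allFuns-suc ys a (λ g → H (φ ∘ g))) ⟩
      ∑[ g ← allFuns ys (suc a) ] H (φ ∘ g)
        ∎
      where
      open ≡-Reasoning
      resp-tail : ∀ x → Respects≈ _≈_ (λ f → H (x Vec.∷ f))
      resp-tail x f g f≈g = resp _ _ λ { Fin.zero → ≈-refl x ; (Fin.suc i) → f≈g i }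
      ∷-∘ : ∀ y (g : Fin a → B) i → (φ y Vec.∷ (φ ∘ g)) i ≈ (φ ∘ (y Vec.∷ g)) i
      ∷-∘ y g Fin.zero    = ≈-refl (φ y)
      ∷-∘ y g (Fin.suc i) = ≈-refl (φ (g i))
      restrict-head : ∀ f → ∑[ x ← xs ] ⟦ Q x ∧ allᵛ (Q ∘ f) ⟧ * H (x Vec.∷ f)
                          ≡ ∑[ y ← ys ] ⟦ allᵛ (Q ∘ f) ⟧ * H (φ y Vec.∷ f)
      restrict-head f = begin
        ∑[ x ← xs ] ⟦ Q x ∧ b ⟧ * H (x Vec.∷ f)
          ≡⟨ sumL-cong (λ x → regroup (Q x) (H (x Vec.∷ f))) xs ⟩
        ∑[ x ← xs ] ⟦ b ⟧ * (⟦ Q x ⟧ * H (x Vec.∷ f))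
          ≡⟨ sumL-*ˡ ⟦ b ⟧ _ xs ⟩
        ⟦ b ⟧ * (∑[ x ← xs ] ⟦ Q x ⟧ * H (x Vec.∷ f))
          ≡⟨ cong (⟦ b ⟧ *_) (restrict (λ x → H (x Vec.∷ f)) resp-tail-head) ⟩
        ⟦ b ⟧ * (∑[ y ← ys ] H (φ y Vec.∷ f))
          ≡⟨ sym (sumL-*ˡ ⟦ b ⟧ _ ys) ⟩
        ∑[ y ← ys ] ⟦ b ⟧ * H (φ y Vec.∷ f)
          ∎
        where
        b = allᵛ (Q ∘ f)
        regroup : ∀ q h → ⟦ q ∧ b ⟧ * h ≡ ⟦ b ⟧ * (⟦ q ⟧ * h)
        regroup q h = trans (cong (_* h) (trans (⟦∧⟧ q b) (*-comm ⟦ q ⟧ ⟦ b ⟧))) (*-assoc ⟦ b ⟧ ⟦ q ⟧ h)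
        resp-tail-head : ∀ x y → x ≈ y → H (x Vec.∷ f) ≡ H (y Vec.∷ f)
        resp-tail-head x y x≈y = resp _ _ λ { Fin.zero → x≈y ; (Fin.suc i) → ≈-refl (f i) }

  sumBelow : ℕ → (ℕ → ℕ) → ℕ
  sumBelow zero    h = 0
  sumBelow (suc K) h = sumBelow K h + h K

  infixr 6.5 sumBelow
  syntax sumBelow K (λ x → e) = ∑[ x < K ] e

  sumBelow-suc : ∀ K (h : ℕ → ℕ) → ∑[ x < suc K ] h x ≡ h 0 + ∑[ x < K ] h (suc x)
  sumBelow-suc zero    h = +-comm 0 (h 0)
  sumBelow-suc (suc K) h = trans (cong (_+ h (suc K)) (sumBelow-suc K h)) (+-assoc (h 0) _ _)

  sumBelow-cong : ∀ {h h′ : ℕ → ℕ} K → (∀ x → x < K → h x ≡ h′ x) → sumBelow K h ≡ sumBelow K h′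
  sumBelow-cong zero    h≗h′ = refl
  sumBelow-cong (suc K) h≗h′ = cong₂ _+_ (sumBelow-cong K (λ x x<K → h≗h′ x (m≤n⇒m≤1+n x<K))) (h≗h′ K ≤-refl)

  sumBelow-zero : ∀ {h : ℕ → ℕ} K → (∀ x → x < K → h x ≡ 0) → sumBelow K h ≡ 0
  sumBelow-zero zero    h≗0 = refl
  sumBelow-zero (suc K) h≗0 = cong₂ _+_ (sumBelow-zero K (λ x x<K → h≗0 x (m≤n⇒m≤1+n x<K))) (h≗0 K ≤-refl)

  sumBelow-+ : ∀ (h : ℕ → ℕ) a b → ∑[ x < a + b ] h x ≡ ∑[ x < a ] h x + ∑[ x < b ] h (a + x)
  sumBelow-+ h a zero    = trans (cong (λ K → sumBelow K h) (+-identityʳ a)) (sym (+-identityʳ _))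
  sumBelow-+ h a (suc b) = begin
    ∑[ x < a + suc b ] h x                          ≡⟨ cong (λ K → sumBelow K h) (+-suc a b) ⟩
    ∑[ x < a + b ] h x + h (a + b)                  ≡⟨ cong (_+ h (a + b)) (sumBelow-+ h a b) ⟩
    ∑[ x < a ] h x + ∑[ x < b ] h (a + x) + h (a + b) ≡⟨ +-assoc (sumBelow a h) _ _ ⟩
    ∑[ x < a ] h x + ∑[ x < suc b ] h (a + x)        ∎
    where open ≡-Reasoning

  sumBelow-reverse : ∀ T (h : ℕ → ℕ) → ∑[ j < suc T ] h (T ∸ j) ≡ ∑[ j < suc T ] h j
  sumBelow-reverse zero    h = refl
  sumBelow-reverse (suc T) h = begin
    ∑[ j < suc (suc T) ] h (suc T ∸ j)     ≡⟨ sumBelow-suc (suc T) (λ j → h (suc T ∸ j)) ⟩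
    h (suc T) + ∑[ j < suc T ] h (T ∸ j)   ≡⟨ cong (h (suc T) +_) (sumBelow-reverse T h) ⟩
    h (suc T) + ∑[ j < suc T ] h j         ≡⟨ +-comm (h (suc T)) _ ⟩
    ∑[ j < suc (suc T) ] h j               ∎
    where open ≡-Reasoning

  sumBelow-truncate : ∀ B (h : ℕ → ℕ) A → ∑[ e < A ] ⟦ e <ᵇ B ⟧ * h e ≡ ∑[ e < A ⊓ B ] h e
  sumBelow-truncate B h zero = refl
  sumBelow-truncate B h (suc A) with A <? B
  ... | yes A<B = begin
    ∑[ e < A ] ⟦ e <ᵇ B ⟧ * h e + ⟦ A <ᵇ B ⟧ * h A
      ≡⟨ cong₂ _+_ (sumBelow-truncate B h A) (cong (λ b → ⟦ b ⟧ * h A) (<ᵇ-true⁺ A<B)) ⟩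
    ∑[ e < A ⊓ B ] h e + 1 * h A
      ≡⟨ cong₂ (λ K y → sumBelow K h + y) (m≤n⇒m⊓n≡m (<⇒≤ A<B)) (*-identityˡ (h A)) ⟩
    ∑[ e < suc A ] h e
      ≡⟨ cong (λ K → sumBelow K h) (sym (m≤n⇒m⊓n≡m A<B)) ⟩
    ∑[ e < suc A ⊓ B ] h e
      ∎
    where open ≡-Reasoning
  ... | no A≮B = begin
    ∑[ e < A ] ⟦ e <ᵇ B ⟧ * h e + ⟦ A <ᵇ B ⟧ * h A
      ≡⟨ cong₂ _+_ (sumBelow-truncate B h A) (cong (λ b → ⟦ b ⟧ * h A) (<ᵇ-false⁺ A≮B)) ⟩
    ∑[ e < A ⊓ B ] h e + 0
      ≡⟨ +-identityʳ _ ⟩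
    ∑[ e < A ⊓ B ] h e
      ≡⟨ cong (λ K → sumBelow K h) (trans (m≥n⇒m⊓n≡n B≤A) (sym (m≥n⇒m⊓n≡n (m≤n⇒m≤1+n B≤A)))) ⟩
    ∑[ e < suc A ⊓ B ] h e
      ∎
    where
    open ≡-Reasoning
    B≤A = ≮⇒≥ A≮B

  sumBelow-swap-bounds : ∀ A B (h : ℕ → ℕ) → ∑[ e < A ] ⟦ e <ᵇ B ⟧ * h e ≡ ∑[ e < B ] ⟦ e <ᵇ A ⟧ * h e
  sumBelow-swap-bounds A B h =
    trans (sumBelow-truncate B h A) (trans (cong (λ K → sumBelow K h) (⊓-comm A B)) (sym (sumBelow-truncate A h B)))

  sumBelow-count-above : ∀ a K → ∑[ x < K ] ⟦ a <ᵇ suc x ⟧ ≡ K ∸ a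
  sumBelow-count-above a zero    = sym (0∸n≡0 a)
  sumBelow-count-above a (suc K) with a ≤? K
  ... | yes a≤K = begin
    ∑[ x < K ] ⟦ a <ᵇ suc x ⟧ + ⟦ a <ᵇ suc K ⟧
      ≡⟨ cong₂ _+_ (sumBelow-count-above a K) (cong ⟦_⟧ (<ᵇ-true⁺ (s≤s a≤K))) ⟩
    K ∸ a + 1
      ≡⟨ +-comm (K ∸ a) 1 ⟩
    suc (K ∸ a)
      ≡⟨ sym (+-∸-assoc 1 a≤K) ⟩
    suc K ∸ a
      ∎
    where open ≡-Reasoning
  ... | no a≰K = begin
    ∑[ x < K ] ⟦ a <ᵇ suc x ⟧ + ⟦ a <ᵇ suc K ⟧
      ≡⟨ cong₂ _+_ (sumBelow-count-above a K) (cong ⟦_⟧ (<ᵇ-false⁺ (a≰K ∘ ≤-pred))) ⟩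
    K ∸ a + 0
      ≡⟨ +-identityʳ _ ⟩
    K ∸ a
      ≡⟨ m≤n⇒m∸n≡0 (<⇒≤ K<a) ⟩
    0
      ≡⟨ sym (m≤n⇒m∸n≡0 K<a) ⟩
    suc K ∸ a
      ∎
    where
    open ≡-Reasoning
    K<a = ≰⇒> a≰K

  sumTo≡sumBelow : ∀ d f → sumTo d f ≡ ∑[ i < suc d ] f i
  sumTo≡sumBelow zero    f = refl
  sumTo≡sumBelow (suc d) f = cong (_+ f (suc d)) (sumTo≡sumBelow d f)

  sumL-applyUpTo : ∀ (f g : ℕ → ℕ) K → sumL f (applyUpTo g K) ≡ ∑[ x < K ] f (g x)
  sumL-applyUpTo f g zero    = refl
  sumL-applyUpTo f g (suc K) =
    trans (cong (f (g 0) +_) (sumL-applyUpTo f (g ∘ suc) K)) (sym (sumBelow-suc K (f ∘ g)))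

  sumL-range1 : ∀ (f : ℕ → ℕ) K → sumL f (range1 K) ≡ ∑[ x < K ] f (suc x)
  sumL-range1 f K = trans (sumL-map f suc (upTo K)) (sumL-applyUpTo (f ∘ suc) id K)

  sumL-allFin-toℕ : ∀ T (h : ℕ → ℕ) → ∑[ x ← allFin T ] h (toℕ x) ≡ ∑[ x < T ] h x
  sumL-allFin-toℕ zero    h = refl
  sumL-allFin-toℕ (suc T) h = begin
    ∑[ x ← allFin (suc T) ] h (toℕ x)       ≡⟨ sumL-allFin-suc {n = T} (h ∘ toℕ) ⟩
    h 0 + ∑[ x ← allFin T ] h (suc (toℕ x)) ≡⟨ cong (h 0 +_) (sumL-allFin-toℕ T (h ∘ suc)) ⟩
    h 0 + ∑[ x < T ] h (suc x)              ≡⟨ sym (sumBelow-suc T h) ⟩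
    ∑[ x < suc T ] h x                      ∎
    where open ≡-Reasoning

  sumL-allFin-inject≤ : ∀ {a b} (a≤b : a ≤ b) (h : Fin b → ℕ) →
    ∑[ x ← allFin b ] ⟦ toℕ x <ᵇ a ⟧ * h x ≡ ∑[ x ← allFin a ] h (inject≤ x a≤b)
  sumL-allFin-inject≤ {zero}  {b}     z≤n       h = sumL-zero (λ _ → refl) (allFin b)
  sumL-allFin-inject≤ {suc a} {suc b} (s≤s a≤b) h = begin
    ∑[ x ← allFin (suc b) ] ⟦ toℕ x <ᵇ suc a ⟧ * h x
      ≡⟨ sumL-allFin-suc (λ x → ⟦ toℕ x <ᵇ suc a ⟧ * h x) ⟩
    1 * h Fin.zero + ∑[ x ← allFin b ] ⟦ toℕ x <ᵇ a ⟧ * h (Fin.suc x)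
      ≡⟨ cong₂ _+_ (*-identityˡ (h Fin.zero)) (sumL-allFin-inject≤ a≤b (h ∘ Fin.suc)) ⟩
    h Fin.zero + ∑[ x ← allFin a ] h (Fin.suc (inject≤ x a≤b))
      ≡⟨ sym (sumL-allFin-suc (λ x → h (inject≤ x (s≤s a≤b)))) ⟩
    ∑[ x ← allFin (suc a) ] h (inject≤ x (s≤s a≤b))
      ∎
    where open ≡-Reasoning

  sumL-allFin-≡ᵇ : ∀ T v → v < T → ∑[ x ← allFin T ] ⟦ toℕ x ≡ᵇ v ⟧ ≡ 1
  sumL-allFin-≡ᵇ (suc T) zero    _         =
    trans (sumL-allFin-suc {n = T} (λ x → ⟦ toℕ x ≡ᵇ 0 ⟧)) (cong suc (sumL-zero (λ _ → refl) (allFin T)))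
  sumL-allFin-≡ᵇ (suc T) (suc v) (s≤s v<T) =
    trans (sumL-allFin-suc {n = T} (λ x → ⟦ toℕ x ≡ᵇ suc v ⟧)) (sumL-allFin-≡ᵇ T v v<T)

  sumL-allFuns-graph : ∀ T a (h : Fin a → ℕ) → (∀ c → h c < T) →
    ∑[ f ← allFuns (allFin T) a ] ⟦ allᵛ (λ c → toℕ (f c) ≡ᵇ h c) ⟧ ≡ 1
  sumL-allFuns-graph T zero    h h<T = refl
  sumL-allFuns-graph T (suc a) h h<T = begin
    ∑[ f ← allFuns (allFin T) (suc a) ] ⟦ allᵛ (λ c → toℕ (f c) ≡ᵇ h c) ⟧
      ≡⟨ sumL-allFuns-suc (allFin T) a _ ⟩
    ∑[ f ← allFuns (allFin T) a ] ∑[ x ← allFin T ] ⟦ (toℕ x ≡ᵇ h Fin.zero) ∧ rest f ⟧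
      ≡⟨ sumL-cong (λ f → sumL-cong (λ x → trans (⟦∧⟧ _ (rest f)) (*-comm _ ⟦ rest f ⟧)) (allFin T)) (allFuns (allFin T) a) ⟩
    ∑[ f ← allFuns (allFin T) a ] ∑[ x ← allFin T ] ⟦ rest f ⟧ * ⟦ toℕ x ≡ᵇ h Fin.zero ⟧
      ≡⟨ sumL-cong (λ f → sumL-*ˡ ⟦ rest f ⟧ _ (allFin T)) (allFuns (allFin T) a) ⟩
    ∑[ f ← allFuns (allFin T) a ] ⟦ rest f ⟧ * (∑[ x ← allFin T ] ⟦ toℕ x ≡ᵇ h Fin.zero ⟧)
      ≡⟨ sumL-cong (λ f → trans (cong (⟦ rest f ⟧ *_) (sumL-allFin-≡ᵇ T _ (h<T Fin.zero))) (*-identityʳ _)) (allFuns (allFin T) a) ⟩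
    ∑[ f ← allFuns (allFin T) a ] ⟦ rest f ⟧
      ≡⟨ sumL-allFuns-graph T a (h ∘ Fin.suc) (h<T ∘ Fin.suc) ⟩
    1 ∎
    where
    open ≡-Reasoning
    rest : (Fin a → Fin T) → Bool
    rest f = allᵛ (λ c → toℕ (f c) ≡ᵇ h (Fin.suc c))

  foldr-tabulate-last : ∀ {n} (f : B → A → A) e (g : Fin (suc n) → B) →
    foldr f e (tabulate g) ≡ foldr f (f (g (fromℕ n)) e) (tabulate (g ∘ inject₁))
  foldr-tabulate-last {n = zero}  f e g = refl
  foldr-tabulate-last {n = suc n} f e g = cong (f (g Fin.zero)) (foldr-tabulate-last f e (g ∘ Fin.suc))

  foldr-allFin-last : ∀ {n} (f : Fin (suc n) → A → A) e →
    foldr f e (allFin (suc n)) ≡ foldr (f ∘ inject₁) (f (fromℕ n) e) (allFin n)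
  foldr-allFin-last {n = n} f e = begin
    foldr f e (allFin (suc n))                        ≡⟨ foldr-tabulate-last f e id ⟩
    foldr f (f (fromℕ n) e) (tabulate inject₁)        ≡⟨ cong (foldr f _) (sym (map-tabulate id inject₁)) ⟩
    foldr f (f (fromℕ n) e) (map inject₁ (allFin n))  ≡⟨ foldr-map f inject₁ _ (allFin n) ⟩
    foldr (f ∘ inject₁) (f (fromℕ n) e) (allFin n)    ∎
    where open ≡-Reasoning

  first : (A → Bool) → (A → ℕ) → ℕ → List A → ℕ
  first P b e = foldr (λ x rest → if P x then b x else rest) e

  module _ (P : A → Bool) (b : A → ℕ) where

    first-default : ∀ {xs} e e′ → Any (λ x → P x ≡ true) xs → first P b e xs ≡ first P b e′ xs
    first-default e e′ (here  Px≡true) rewrite Px≡true = refl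
    first-default e e′ (there {x = x} found) with P x
    ... | true  = refl
    ... | false = first-default e e′ found

    first-none : ∀ {xs} e → All (λ x → P x ≡ false) xs → first P b e xs ≡ e
    first-none e []                    = refl
    first-none e (Px≡false ∷ missing) rewrite Px≡false = first-none e missing

    first-≤ : ∀ {N} e xs → e ≤ N → (∀ x → b x ≤ N) → first P b e xs ≤ N
    first-≤ e []       e≤N b≤N = e≤N
    first-≤ e (x ∷ xs) e≤N b≤N with P x
    ... | true  = b≤N x
    ... | false = first-≤ e xs e≤N b≤N

module ColouredPartitions (m′ : ℕ) where

  open import Data.Nat using (ℕ; zero; suc; _+_; _*_; _∸_; _≤_; _<_; z≤n; s≤s; z<s; _<?_; _≤?_; _<ᵇ_; _≡ᵇ_)
  open import Data.Nat.Properties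
  open import Data.Nat.DivMod
  import Data.Integer as ℤ
  open import Data.Fin using (Fin; toℕ; fromℕ<; fromℕ; inject₁; inject≤)
  open import Data.Fin.Properties using (toℕ<n; toℕ-fromℕ<; toℕ-inject₁; toℕ-fromℕ; toℕ-inject≤; any?)
  open import Data.Fin.Relation.Unary.Top using (view; ‵fromℕ; ‵inject₁)
  open import Data.List using (List; map; concatMap; foldr; allFin; upTo)
  open import Data.List.Properties using (foldr-cong)
  import Data.List.Relation.Unary.All.Properties as All
  import Data.List.Relation.Unary.Any.Properties as Any
  open import Data.Bool using (Bool; true; false; _∧_; _∨_; not; if_then_else_)
  open import Data.Bool.Properties using (∧-identityʳ; ∧-zeroʳ)
  open import Data.Bool.ListAction using (all; any)
  open import Data.Product using (∃; _×_; _,_; proj₁; proj₂)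
  open import Data.Sum using (_⊎_; inj₁; inj₂)
  open import Function using (_∘_; _⇔_; mk⇔; Equivalence)
  open import Relation.Binary.PropositionalEquality
  open import Relation.Nullary using (Dec; ¬_; ¬?; yes; no; contradiction)
  open import Relation.Nullary.Decidable using (decidable-stable)
  open import Defs using (module Partition; range1; allFuns; sumTo; qint; S[_,_,_])
  open FiniteSums

  m : ℕ
  m = suc m′

  quotient-remainder-unique : ∀ l a l′ b → a < m → b < m → l * m + a ≡ l′ * m + b → l ≡ l′ × a ≡ b
  quotient-remainder-unique l a l′ b a<m b<m eq = l≡l′ , a≡b
    where
    open ≡-Reasoning
    a≡b : a ≡ b
    a≡b = begin
      a                ≡⟨ sym (m<n⇒m%n≡m a<m) ⟩
      a % m            ≡⟨ sym ([m+kn]%n≡m%n a l m) ⟩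
      (a + l * m) % m  ≡⟨ cong (_% m) (trans (+-comm a (l * m)) (trans eq (+-comm (l′ * m) b))) ⟩
      (b + l′ * m) % m ≡⟨ [m+kn]%n≡m%n b l′ m ⟩
      b % m            ≡⟨ m<n⇒m%n≡m b<m ⟩
      b                ∎
    l≡l′ : l ≡ l′
    l≡l′ = *-cancelʳ-≡ l l′ m (+-cancelʳ-≡ _ (l * m) (l′ * m) (trans eq (cong (l′ * m +_) (sym a≡b))))

  j≡[j/m]*m+j%m : ∀ j → j ≡ j / m * m + j % m
  j≡[j/m]*m+j%m j = trans (m≡m%n+[m/n]*n j m) (+-comm (j % m) _)

  [a+b%m]%m≡[a+b]%m : ∀ a b → (a + b % m) % m ≡ (a + b) % m
  [a+b%m]%m≡[a+b]%m a b = begin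
    (a + b % m) % m         ≡⟨ %-distribˡ-+ a (b % m) m ⟩
    (a % m + b % m % m) % m ≡⟨ cong (λ x → (a % m + x) % m) (m%n%n≡m%n b m) ⟩
    (a % m + b % m) % m     ≡⟨ sym (%-distribˡ-+ a b m) ⟩
    (a + b) % m             ∎
    where open ≡-Reasoning

  [a%m+b]%m≡[a+b]%m : ∀ a b → (a % m + b) % m ≡ (a + b) % m
  [a%m+b]%m≡[a+b]%m a b = trans (cong (_% m) (+-comm (a % m) b)) (trans ([a+b%m]%m≡[a+b]%m b a) (cong (_% m) (+-comm b a)))

  [x+t]%m≡t⇒x≡0 : ∀ x t → x < m → t < m → (x + t) % m ≡ t → x ≡ 0
  [x+t]%m≡t⇒x≡0 x t x<m t<m eq with x + t <? m
  ... | yes x+t<m = +-cancelʳ-≡ t x 0 (trans (sym (m<n⇒m%n≡m x+t<m)) eq)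
  ... | no  x+t≮m = contradiction x≡m (<⇒≢ x<m)
    where
    open ≡-Reasoning
    y = x + t ∸ m
    y+m≡x+t : y + m ≡ x + t
    y+m≡x+t = m∸n+n≡m (≮⇒≥ x+t≮m)
    y≡t : y ≡ t
    y≡t = begin
      y           ≡⟨ sym (m<n⇒m%n≡m (+-cancelʳ-< m y m (subst (_< m + m) (sym y+m≡x+t) (+-mono-< x<m t<m)))) ⟩
      y % m       ≡⟨ sym ([m+n]%n≡m%n y m) ⟩
      (y + m) % m ≡⟨ cong (_% m) y+m≡x+t ⟩
      (x + t) % m ≡⟨ eq ⟩
      t           ∎
    x≡m : x ≡ m
    x≡m = +-cancelʳ-≡ t x m (trans (sym y+m≡x+t) (trans (cong (_+ m) y≡t) (+-comm t m)))

  shift-preimage : ∀ (c : Fin m) t → t < m → ∃ λ (c′ : Fin m) → (toℕ c′ + t) % m ≡ toℕ c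
  shift-preimage c t t<m = fromℕ< (m%n<n (toℕ c + (m ∸ t)) m) , (begin
    (toℕ (fromℕ< (m%n<n (toℕ c + (m ∸ t)) m)) + t) % m
      ≡⟨ cong (λ x → (x + t) % m) (toℕ-fromℕ< (m%n<n (toℕ c + (m ∸ t)) m)) ⟩
    ((toℕ c + (m ∸ t)) % m + t) % m
      ≡⟨ [a%m+b]%m≡[a+b]%m (toℕ c + (m ∸ t)) t ⟩
    (toℕ c + (m ∸ t) + t) % m
      ≡⟨ cong (_% m) (trans (+-assoc (toℕ c) _ t) (cong (toℕ c +_) (m∸n+n≡m (<⇒≤ t<m)))) ⟩
    (toℕ c + m) % m
      ≡⟨ [m+n]%n≡m%n (toℕ c) m ⟩
    toℕ c % m
      ≡⟨ m<n⇒m%n≡m (toℕ<n c) ⟩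
    toℕ c
      ∎)
    where open ≡-Reasoning

  m+1+n≡1+m+n : ∀ a t → a + 1 + t ≡ suc (a + t)
  m+1+n≡1+m+n a t = trans (+-assoc a 1 t) (+-suc a t)

  m+1≡1+m+0 : ∀ a → a + 1 ≡ suc (a + 0)
  m+1≡1+m+0 a = trans (sym (+-identityʳ (a + 1))) (m+1+n≡1+m+n a 0)

  <-suc*-split : ∀ k′ j → j < suc k′ * m → j < k′ * m ⊎ ∃ λ u → u < m × j ≡ k′ * m + u
  <-suc*-split k′ j j<[1+k′]m with j <? k′ * m
  ... | yes j<k′m = inj₁ j<k′m
  ... | no  j≮k′m = inj₂ (j ∸ k′ * m , u<m , sym (m+[n∸m]≡n k′m≤j))
    where
    k′m≤j = ≮⇒≥ j≮k′m
    u<m : j ∸ k′ * m < m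
    u<m = +-cancelʳ-< (k′ * m) (j ∸ k′ * m) m (subst (_< m + k′ * m) (sym (m∸n+n≡m k′m≤j)) j<[1+k′]m)

  Row : Set
  Row = Fin m → ℕ

  ZeroClosed : Row → Set
  ZeroClosed r = ∀ c d → r c ≡ 0 → r d ≡ 0

  Rotating : ℕ → Row → Set
  Rotating k r = ∀ l t (c c′ : Fin m) → l < k → t < m → (toℕ c′ + t) % m ≡ toℕ c →
                 (r c ≡ l * m + 1 + t) ⇔ (r c′ ≡ l * m + 1)

  -- The blocks S_{lm+1}, …, S_{lm+m} are ζ⁰S, …, ζ^{m-1}S for S = S_{lm+1}, so the base whose
  -- colour-0 point lies in S_{lm+1+t} has its colour-c point in S_{lm+1+((t+c) mod m)}.
  canonical : ℕ → Row
  canonical zero    c = 0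
  canonical (suc j) c = suc (j / m * m + (j % m + toℕ c) % m)

  canonical-position : ∀ j l t (c : Fin m) → t < m → canonical (suc j) c ≡ suc (l * m + t) →
                       j / m ≡ l × (j % m + toℕ c) % m ≡ t
  canonical-position j l t c t<m eq =
    quotient-remainder-unique (j / m) ((j % m + toℕ c) % m) l t (m%n<n (j % m + toℕ c) m) t<m (suc-injective eq)

  canonical-form : ∀ l t (c : Fin m) → t < m → canonical (suc (l * m + t)) c ≡ suc (l * m + (t + toℕ c) % m)
  canonical-form l t c t<m with quotient-remainder-unique ((l * m + t) / m) ((l * m + t) % m) l t (m%n<n (l * m + t) m) t<m
                                                      (sym (j≡[j/m]*m+j%m (l * m + t)))
  ... | l≡ , t≡ = cong suc (cong₂ (λ a b → a * m + (b + toℕ c) % m) l≡ t≡)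

  canonical-zero : ∀ j → canonical j Fin.zero ≡ j
  canonical-zero zero    = refl
  canonical-zero (suc j) = cong suc (begin
    j / m * m + (j % m + 0) % m ≡⟨ cong (λ x → j / m * m + x % m) (+-identityʳ (j % m)) ⟩
    j / m * m + j % m % m       ≡⟨ cong (j / m * m +_) (m%n%n≡m%n j m) ⟩
    j / m * m + j % m           ≡⟨ sym (j≡[j/m]*m+j%m j) ⟩
    j                           ∎)
    where open ≡-Reasoning

  canonical-≤ : ∀ k j (c : Fin m) → j ≤ k * m → canonical j c ≤ k * m
  canonical-≤ k zero    c _      = z≤n
  canonical-≤ k (suc j) c j<k*m = begin
    suc (j / m * m + (j % m + toℕ c) % m) ≤⟨ s≤s (+-monoʳ-≤ (j / m * m) (<⇒≤pred (m%n<n (j % m + toℕ c) m))) ⟩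
    suc (j / m * m + m′)                  ≡⟨ cong suc (+-comm (j / m * m) m′) ⟩
    suc (j / m) * m                       ≤⟨ *-monoˡ-≤ m (m<n*o⇒m/o<n {j} {k} {m} j<k*m) ⟩
    k * m                                 ∎
    where open ≤-Reasoning

  canonical-zeroClosed : ∀ j → ZeroClosed (canonical j)
  canonical-zeroClosed zero    c d _  = refl
  canonical-zeroClosed (suc j) c d ()

  canonical-rotating : ∀ k j → Rotating k (canonical j)
  canonical-rotating k zero    l t c c′ _ _ _ = mk⇔ (λ 0≡ → contradiction (trans 0≡ (m+1+n≡1+m+n (l * m) t)) 0≢1+n)
                                                    (λ 0≡ → contradiction (trans 0≡ (m+1≡1+m+0 (l * m))) 0≢1+n)
  canonical-rotating k (suc j) l t c c′ _ t<m c′+t≡c = mk⇔ to from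
    where
    open ≡-Reasoning
    X : Fin m → ℕ
    X d = (j % m + toℕ d) % m
    X-shift : X c ≡ (X c′ + t) % m
    X-shift = begin
      (j % m + toℕ c) % m              ≡⟨ cong (λ x → (j % m + x) % m) (sym c′+t≡c) ⟩
      (j % m + (toℕ c′ + t) % m) % m   ≡⟨ [a+b%m]%m≡[a+b]%m (j % m) _ ⟩
      (j % m + (toℕ c′ + t)) % m       ≡⟨ cong (_% m) (sym (+-assoc (j % m) _ t)) ⟩
      (j % m + toℕ c′ + t) % m         ≡⟨ sym ([a%m+b]%m≡[a+b]%m (j % m + toℕ c′) t) ⟩
      (X c′ + t) % m                   ∎
    to : canonical (suc j) c ≡ l * m + 1 + t → canonical (suc j) c′ ≡ l * m + 1
    to eq with canonical-position j l t c t<m (trans eq (m+1+n≡1+m+n (l * m) t))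
    ... | refl , Xc≡t = begin
      suc (j / m * m + X c′) ≡⟨ cong (λ x → suc (j / m * m + x)) X′≡0 ⟩
      suc (j / m * m + 0)    ≡⟨ sym (m+1≡1+m+0 (j / m * m)) ⟩
      j / m * m + 1          ∎
      where
      X′≡0 : X c′ ≡ 0
      X′≡0 = [x+t]%m≡t⇒x≡0 (X c′) t (m%n<n (j % m + toℕ c′) m) t<m (trans (sym X-shift) Xc≡t)
    from : canonical (suc j) c′ ≡ l * m + 1 → canonical (suc j) c ≡ l * m + 1 + t
    from eq with canonical-position j l 0 c′ (s≤s z≤n) (trans eq (m+1≡1+m+0 (l * m)))
    ... | refl , X′≡0 = begin
      suc (j / m * m + X c)  ≡⟨ cong (λ x → suc (j / m * m + x)) (trans X-shift (cong (λ x → (x + t) % m) X′≡0)) ⟩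
      suc (j / m * m + t % m) ≡⟨ cong (λ x → suc (j / m * m + x)) (m<n⇒m%n≡m t<m) ⟩
      suc (j / m * m + t)    ≡⟨ sym (m+1+n≡1+m+n (j / m * m) t) ⟩
      j / m * m + 1 + t      ∎

  canonical-unique : ∀ k r → ZeroClosed r → Rotating k r → r Fin.zero ≤ k * m →
                     ∀ c → r c ≡ canonical (r Fin.zero) c
  canonical-unique k r closed rotating r₀≤km c with r Fin.zero in r₀≡
  ... | zero  = closed Fin.zero c r₀≡
  ... | suc j = begin
    r c                 ≡⟨ Equivalence.from (rotating l₀ t c c₀ l₀<k (m%n<n (t₀ + toℕ c) m) c₀+t≡c) r[c₀]≡ ⟩
    l₀ * m + 1 + t      ≡⟨ m+1+n≡1+m+n (l₀ * m) t ⟩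
    canonical (suc j) c ∎
    where
    open ≡-Reasoning
    l₀ = j / m
    t₀ = j % m
    t = (t₀ + toℕ c) % m
    l₀<k : l₀ < k
    l₀<k = m<n*o⇒m/o<n {j} {k} {m} r₀≤km
    c₀ = proj₁ (shift-preimage Fin.zero t₀ (m%n<n j m))
    c₀+t₀≡0 = proj₂ (shift-preimage Fin.zero t₀ (m%n<n j m))
    r[c₀]≡ : r c₀ ≡ l₀ * m + 1
    r[c₀]≡ = Equivalence.to (rotating l₀ t₀ Fin.zero c₀ l₀<k (m%n<n j m) c₀+t₀≡0)
               (trans r₀≡ (trans (cong suc (j≡[j/m]*m+j%m j)) (sym (m+1+n≡1+m+n (l₀ * m) t₀))))
    c₀+t≡c : (toℕ c₀ + t) % m ≡ toℕ c
    c₀+t≡c = begin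
      (toℕ c₀ + (t₀ + toℕ c) % m) % m ≡⟨ [a+b%m]%m≡[a+b]%m (toℕ c₀) _ ⟩
      (toℕ c₀ + (t₀ + toℕ c)) % m     ≡⟨ cong (_% m) (sym (+-assoc (toℕ c₀) t₀ _)) ⟩
      (toℕ c₀ + t₀ + toℕ c) % m       ≡⟨ sym ([a%m+b]%m≡[a+b]%m (toℕ c₀ + t₀) _) ⟩
      ((toℕ c₀ + t₀) % m + toℕ c) % m ≡⟨ cong (λ x → (x + toℕ c) % m) c₀+t₀≡0 ⟩
      toℕ c % m                       ≡⟨ m<n⇒m%n≡m (toℕ<n c) ⟩
      toℕ c                           ∎

  canonical-newBlock : ∀ k′ u → u < m →
    ∃ λ (c : Fin m) → toℕ c ≡ suc (k′ * m + u) % m × canonical (suc k′ * m) c ≡ suc (k′ * m + u)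
  canonical-newBlock k′ u u<m = c , toℕ-fromℕ< (m%n<n (suc (k′ * m + u)) m) , (begin
    canonical (suc (m′ + k′ * m)) c ≡⟨ cong (λ x → canonical (suc x) c) (+-comm m′ (k′ * m)) ⟩
    canonical (suc (k′ * m + m′)) c ≡⟨ canonical-form k′ m′ c ≤-refl ⟩
    suc (k′ * m + (m′ + toℕ c) % m) ≡⟨ cong (λ x → suc (k′ * m + x)) m′+c≡u ⟩
    suc (k′ * m + u)                ∎)
    where
    open ≡-Reasoning
    c : Fin m
    c = fromℕ< (m%n<n (suc (k′ * m + u)) m)
    m′+c≡u : (m′ + toℕ c) % m ≡ u
    m′+c≡u = begin
      (m′ + toℕ c) % m
        ≡⟨ cong (λ x → (m′ + x) % m) (toℕ-fromℕ< (m%n<n (suc (k′ * m + u)) m)) ⟩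
      (m′ + suc (k′ * m + u) % m) % m
        ≡⟨ [a+b%m]%m≡[a+b]%m m′ _ ⟩
      (m′ + suc (k′ * m + u)) % m
        ≡⟨ cong (_% m) (trans (+-suc m′ _) (trans (cong (m +_) (+-comm (k′ * m) u)) (+-comm m (u + k′ * m)))) ⟩
      (u + k′ * m + m) % m
        ≡⟨ [m+n]%n≡m%n (u + k′ * m) m ⟩
      (u + k′ * m) % m
        ≡⟨ [m+kn]%n≡m%n u k′ m ⟩
      u % m
        ≡⟨ m<n⇒m%n≡m u<m ⟩
      u
        ∎

  rotating-first : ∀ {k r} → Rotating k r → ∀ {l t c} → l < k → t < m →
                   r c ≡ l * m + 1 + t → ∃ λ c′ → r c′ ≡ l * m + 1
  rotating-first rotating {l} {t} {c} l<k t<m r[c]≡ =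
    let c′ , c′+t≡c = shift-preimage c t t<m
    in c′ , Equivalence.to (rotating l t c c′ l<k t<m c′+t≡c) r[c]≡

  rotating-shift : ∀ {k r} → Rotating k r → ∀ {l t c′} → l < k → t < m →
                   r c′ ≡ l * m + 1 → ∃ λ c → r c ≡ l * m + 1 + t
  rotating-shift rotating {l} {t} {c′} l<k t<m r[c′]≡ =
    c , Equivalence.from (rotating l t c c′ l<k t<m (sym (toℕ-fromℕ< (m%n<n (toℕ c′ + t) m)))) r[c′]≡
    where c = fromℕ< (m%n<n (toℕ c′ + t) m)

  ZeroClosed-resp : ∀ {r r′} → (∀ c → r c ≡ r′ c) → ZeroClosed r → ZeroClosed r′
  ZeroClosed-resp r≗r′ closed c d r′c≡0 = trans (sym (r≗r′ d)) (closed c d (trans (r≗r′ c) r′c≡0))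

  Rotating-resp : ∀ {k r r′} → (∀ c → r c ≡ r′ c) → Rotating k r → Rotating k r′
  Rotating-resp r≗r′ rotating l t c c′ l<k t<m c′+t≡c = mk⇔
    (λ eq → trans (sym (r≗r′ c′)) (Equivalence.to   e (trans (r≗r′ c) eq)))
    (λ eq → trans (sym (r≗r′ c))  (Equivalence.from e (trans (r≗r′ c′) eq)))
    where e = rotating l t c c′ l<k t<m c′+t≡c

  Rotating-≤ : ∀ {k k′ r} → k′ ≤ k → Rotating k r → Rotating k′ r
  Rotating-≤ k′≤k rotating l t c c′ l<k′ = rotating l t c c′ (<-≤-trans l<k′ k′≤k)

  Rotating-suc : ∀ {k′ r} → (∀ c → r c ≤ k′ * m) → Rotating k′ r → Rotating (suc k′) r
  Rotating-suc {k′} {r} r≤ rotating l t c c′ l<1+k′ t<m c′+t≡c with l <? k′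
  ... | yes l<k′ = rotating l t c c′ l<k′ t<m c′+t≡c
  ... | no  l≮k′ = mk⇔ (λ eq → contradiction eq (beyond c (<-≤-trans (m<m+n (l * m) z<s) (m≤m+n (l * m + 1) t))))
                       (λ eq → contradiction eq (beyond c′ (m<m+n (l * m) z<s)))
    where
    l≡k′ : l ≡ k′
    l≡k′ = ≤-antisym (≤-pred l<1+k′) (≮⇒≥ l≮k′)
    beyond : ∀ d {x} → l * m < x → r d ≢ x
    beyond d lm<x eq = <⇒≱ lm<x (subst₂ _≤_ eq (cong (_* m) (sym l≡k′)) (r≤ d))

  Canonical : Row → Set
  Canonical r = ∀ c → r c ≡ canonical (r Fin.zero) c

  Canonical-zeroClosed : ∀ {r} → Canonical r → ZeroClosed r
  Canonical-zeroClosed {r} r≗ = ZeroClosed-resp (sym ∘ r≗) (canonical-zeroClosed (r Fin.zero))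

  Canonical-rotating : ∀ {r} k → Canonical r → Rotating k r
  Canonical-rotating {r} k r≗ = Rotating-resp (sym ∘ r≗) (canonical-rotating k (r Fin.zero))

  Canonical-newBlock : ∀ {r k′} → Canonical r → r Fin.zero ≡ suc k′ * m → ∀ u → u < m →
                       ∃ λ c → toℕ c ≡ suc (k′ * m + u) % m × r c ≡ suc (k′ * m + u)
  Canonical-newBlock {r} {k′} r-canonical r₀≡ u u<m =
    let c , c≡ , canonical≡ = canonical-newBlock k′ u u<m in
    c , c≡ , trans (r-canonical c) (trans (cong (λ x → canonical x c) r₀≡) canonical≡)

  Labelling : ℕ → Set
  Labelling n = Fin n → Row

  toℕ-labels : ∀ {n B} → (Fin n → Fin m → Fin B) → Labelling n
  toℕ-labels L i c = toℕ (L i c)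

  base : ∀ {n} → Fin n → ℕ
  base i = suc (toℕ i)

  -- Defs.Partition with the block labels read as natural numbers, so that one labelling
  -- can be tested for standardness with different numbers k of block groups.
  module Std {n} (V : Labelling n) where

    mem : Fin n → Fin m → ℕ → Bool
    mem i c j = V i c ≡ᵇ j

    baseIn : Fin n → ℕ → Bool
    baseIn i j = any (λ c → mem i c j) (allFin m)

    minb : ℕ → ℕ
    minb zero    = 0
    minb (suc j) = foldr (λ i rest → if baseIn i (suc j) then base i else rest) 0 (allFin n)

    module _ (k : ℕ) where

      open Partition m n k using (_⇔ᵇ_)

      nonempty : Bool
      nonempty = all (λ j → any (λ i → baseIn i j) (allFin n)) (range1 (k * m))

      condI : Bool
      condI = all (λ i → all (λ c → all (λ d → not (mem i c 0) ∨ mem i d 0) (allFin m)) (allFin m)) (allFin n)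

      condII : Bool
      condII = all (λ l → all (λ t → all (λ i → all (λ c → all (λ c′ →
                 not (((toℕ c′ + t) % m) ≡ᵇ toℕ c)
                 ∨ (mem i c (l * m + 1 + t) ⇔ᵇ mem i c′ (l * m + 1)))
                 (allFin m)) (allFin m)) (allFin n)) (upTo m)) (upTo k)

      ordered : Bool
      ordered = all (λ l → minb (l * m) <ᵇ minb (suc l * m)) (upTo k)

      colorCond : Bool
      colorCond = all (λ j → any (λ i → any (λ c →
                    (base i ≡ᵇ minb j) ∧ (toℕ c ≡ᵇ (j % m)) ∧ mem i c j) (allFin m)) (allFin n))
                    (range1 (k * m))

      isStd : Bool
      isStd = nonempty ∧ condI ∧ condII ∧ ordered ∧ colorCond

      inversionsAt : Fin n → ℕ
      inversionsAt i = ∑[ x < k * m ] ⟦ (V i Fin.zero <ᵇ suc x) ∧ not (base i <ᵇ minb (suc x)) ⟧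

      inversions : ℕ
      inversions = ∑[ i ← allFin n ] inversionsAt i

  Occupied : ∀ {n} → Labelling n → ℕ → Set
  Occupied V j = ∃ λ i → ∃ λ c → V i c ≡ j

  record IsStd {n} (k : ℕ) (V : Labelling n) : Set where
    open Std V using (minb)
    field
      occupied   : ∀ j → j < k * m → Occupied V (suc j)
      zeroClosed : ∀ i → ZeroClosed (V i)
      rotating   : ∀ i → Rotating k (V i)
      increasing : ∀ l → l < k → minb (l * m) < minb (suc l * m)
      coloured   : ∀ j → j < k * m →
                   ∃ λ i → ∃ λ c → base i ≡ minb (suc j) × toℕ c ≡ suc j % m × V i c ≡ suc j

  module _ {n} (V : Labelling n) (k : ℕ) where

    open Std V
    open Partition m n k using (_⇔ᵇ_)

    ⇔ᵇ-true⁻ : ∀ {a b} → a ⇔ᵇ b ≡ true → a ≡ b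
    ⇔ᵇ-true⁻ {true}  {true}  _ = refl
    ⇔ᵇ-true⁻ {false} {false} _ = refl

    ⇔ᵇ-true⁺ : ∀ {a b} → a ≡ b → a ⇔ᵇ b ≡ true
    ⇔ᵇ-true⁺ {true}  refl = refl
    ⇔ᵇ-true⁺ {false} refl = refl

    isStd⁻ : isStd k ≡ true → IsStd k V
    isStd⁻ h with ∧-true⁻ {nonempty k} h
    ... | ne , h₁ with ∧-true⁻ {condI k} h₁
    ... | cI , h₂ with ∧-true⁻ {condII k} h₂
    ... | cII , h₃ with ∧-true⁻ {ordered k} h₃
    ... | ord , cc = record
      { occupied   = λ j j<km →
          let i , i∈ = any-allFin⁻ _ (all-range1⁻ _ ne j<km) ; c , Vic≡ = any-allFin⁻ _ i∈ in
          i , c , ≡ᵇ-true⁻ Vic≡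
      ; zeroClosed = λ i c d Vic≡0 → ≡ᵇ-true⁻ (→-true⁻ (condI-at i c d) (≡ᵇ-true⁺ Vic≡0))
      ; rotating   = λ i l t c c′ l<k t<m c′+t≡c →
          ≡ᵇ-cong⁻ (⇔ᵇ-true⁻ (→-true⁻ (condII-at l<k t<m i c c′) (≡ᵇ-true⁺ c′+t≡c)))
      ; increasing = λ l l<k → <ᵇ-true⁻ (all-upTo⁻ _ ord l<k)
      ; coloured   = coloured
      }
      where
      condI-at : ∀ i c d → not (mem i c 0) ∨ mem i d 0 ≡ true
      condI-at i c d = all-allFin⁻ _ (all-allFin⁻ _ (all-allFin⁻ _ cI i) c) d
      condII-at : ∀ {l t} → l < k → t < m → ∀ i c c′ →
                  not (((toℕ c′ + t) % m) ≡ᵇ toℕ c) ∨ (mem i c (l * m + 1 + t) ⇔ᵇ mem i c′ (l * m + 1)) ≡ true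
      condII-at l<k t<m i c c′ = all-allFin⁻ _ (all-allFin⁻ _ (all-allFin⁻ _ (all-upTo⁻ _ (all-upTo⁻ _ cII l<k) t<m) i) c) c′
      coloured : ∀ j → j < k * m →
                 ∃ λ i → ∃ λ c → base i ≡ minb (suc j) × toℕ c ≡ suc j % m × V i c ≡ suc j
      coloured j j<km with any-allFin⁻ _ (all-range1⁻ _ cc j<km)
      ... | i , i∈ with any-allFin⁻ _ i∈
      ... | c , c∈ with ∧-true⁻ c∈
      ... | b≡ , c∈′ with ∧-true⁻ c∈′
      ... | c≡ , V≡ = i , c , ≡ᵇ-true⁻ b≡ , ≡ᵇ-true⁻ c≡ , ≡ᵇ-true⁻ V≡

    isStd⁺ : IsStd k V → isStd k ≡ true
    isStd⁺ s = ∧-true⁺ ne (∧-true⁺ cI (∧-true⁺ cII (∧-true⁺ ord cc)))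
      where
      open IsStd s
      ne : nonempty k ≡ true
      ne = all-range1⁺ _ λ {j} j<km → let i , c , Vic≡ = occupied j j<km in
        any-allFin⁺ _ i (any-allFin⁺ _ c (≡ᵇ-true⁺ Vic≡))
      cI : condI k ≡ true
      cI = all-allFin⁺ _ λ i → all-allFin⁺ _ λ c → all-allFin⁺ _ λ d →
        →-true⁺ (≡ᵇ-true⁺ ∘ zeroClosed i c d ∘ ≡ᵇ-true⁻)
      cII : condII k ≡ true
      cII = all-upTo⁺ _ λ {l} l<k → all-upTo⁺ _ λ {t} t<m →
        all-allFin⁺ _ λ i → all-allFin⁺ _ λ c → all-allFin⁺ _ λ c′ → →-true⁺ λ c′+t≡c →
        ⇔ᵇ-true⁺ (≡ᵇ-cong⁺ (rotating i l t c c′ l<k t<m (≡ᵇ-true⁻ c′+t≡c)))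
      ord : ordered k ≡ true
      ord = all-upTo⁺ _ λ {l} l<k → <ᵇ-true⁺ (increasing l l<k)
      cc : colorCond k ≡ true
      cc = all-range1⁺ _ λ {j} j<km → let i , c , b≡ , c≡ , V≡ = coloured j j<km in
        any-allFin⁺ _ i (any-allFin⁺ _ c (∧-true⁺ (≡ᵇ-true⁺ b≡) (∧-true⁺ (≡ᵇ-true⁺ c≡) (≡ᵇ-true⁺ V≡))))

  _≗₂_ : ∀ {n} → Labelling n → Labelling n → Set
  V ≗₂ W = ∀ i c → V i c ≡ W i c

  module _ {n} {V W : Labelling n} (V≗W : V ≗₂ W) where

    private
      module V = Std V
      module W = Std W

    baseIn-cong : ∀ i j → V.baseIn i j ≡ W.baseIn i j
    baseIn-cong i j = any-cong (λ c → cong (_≡ᵇ j) (V≗W i c)) (allFin m)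

    minb-cong : ∀ j → V.minb j ≡ W.minb j
    minb-cong zero    = refl
    minb-cong (suc j) = foldr-cong (λ i rest → cong (λ b → if b then base i else rest) (baseIn-cong i (suc j)))
                                   refl (allFin n)

    IsStd-resp : ∀ {k} → IsStd k V → IsStd k W
    IsStd-resp s = record
      { occupied   = λ j j<km → let i , c , Vic≡ = occupied j j<km in i , c , trans (sym (V≗W i c)) Vic≡
      ; zeroClosed = λ i → ZeroClosed-resp (V≗W i) (zeroClosed i)
      ; rotating   = λ i → Rotating-resp (V≗W i) (rotating i)
      ; increasing = λ l l<k → subst₂ _<_ (minb-cong (l * m)) (minb-cong (suc l * m)) (increasing l l<k)
      ; coloured   = λ j j<km → let i , c , b≡ , c≡ , V≡ = coloured j j<km in
                       i , c , trans b≡ (minb-cong (suc j)) , c≡ , trans (sym (V≗W i c)) V≡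
      }
      where open IsStd s

    inversions-cong : ∀ k → V.inversions k ≡ W.inversions k
    inversions-cong k = sumL-cong (λ i → sumBelow-cong (k * m) λ x _ →
      cong₂ (λ a b → ⟦ (a <ᵇ suc x) ∧ not (base i <ᵇ b) ⟧) (V≗W i Fin.zero) (minb-cong (suc x))) (allFin n)

  isStd-cong : ∀ {n} {V W : Labelling n} → V ≗₂ W → ∀ k → Std.isStd V k ≡ Std.isStd W k
  isStd-cong V≗W k = true-injective (isStd⁺ _ k ∘ IsStd-resp V≗W ∘ isStd⁻ _ k)
                                    (isStd⁺ _ k ∘ IsStd-resp (λ i c → sym (V≗W i c)) ∘ isStd⁻ _ k)

  module _ {n k} (L : Partition.Lab m n k) where

    private
      module P = Partition m n k
      module S = Std (toℕ-labels L)

    minb-toℕ : ∀ j → P.minb L j ≡ S.minb j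
    minb-toℕ zero    = refl
    minb-toℕ (suc j) = refl

    isStd-toℕ : P.isStd L ≡ S.isStd k
    isStd-toℕ = cong₂ (λ o c → S.nonempty k ∧ S.condI k ∧ S.condII k ∧ o ∧ c)
      (all-cong (λ l → cong₂ _<ᵇ_ (minb-toℕ (l * m)) (minb-toℕ (suc l * m))) (upTo k))
      (all-cong (λ j → any-cong (λ i → any-cong (λ c →
        cong (λ b → (base i ≡ᵇ b) ∧ (toℕ c ≡ᵇ (j % m)) ∧ S.mem i c j) (minb-toℕ j)) (allFin m)) (allFin n))
        (range1 (k * m)))

    inv-toℕ : P.inv L ≡ S.inversions k
    inv-toℕ = begin
      P.inv L
        ≡⟨ count≡∑ (λ b → b) (concatMap tests (allFin n)) ⟩
      sumL ⟦_⟧ (concatMap tests (allFin n))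
        ≡⟨ sumL-concatMap ⟦_⟧ tests (allFin n) ⟩
      ∑[ i ← allFin n ] sumL ⟦_⟧ (tests i)
        ≡⟨ sumL-cong colour-zero-only (allFin n) ⟩
      ∑[ i ← allFin n ] ∑[ l ← range1 (k * m) ] ⟦ inverts i Fin.zero l ⟧
        ≡⟨ sumL-cong (λ i → sumL-range1 _ (k * m)) (allFin n) ⟩
      S.inversions k
        ∎
      where
      open ≡-Reasoning
      inverts : Fin n → Fin m → ℕ → Bool
      inverts i c l = (toℕ c ≡ᵇ 0) ∧ (toℕ (L i c) <ᵇ l) ∧ not (base i <ᵇ P.minb L l)
      tests : Fin n → List Bool
      tests i = concatMap (λ c → map (inverts i c) (range1 (k * m))) (allFin m)
      colour-zero-only : ∀ i → sumL ⟦_⟧ (tests i) ≡ ∑[ l ← range1 (k * m) ] ⟦ inverts i Fin.zero l ⟧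
      colour-zero-only i = begin
        sumL ⟦_⟧ (tests i)
          ≡⟨ sumL-concatMap ⟦_⟧ (λ c → map (inverts i c) (range1 (k * m))) (allFin m) ⟩
        ∑[ c ← allFin m ] sumL ⟦_⟧ (map (inverts i c) (range1 (k * m)))
          ≡⟨ sumL-cong (λ c → sumL-map ⟦_⟧ (inverts i c) (range1 (k * m))) (allFin m) ⟩
        ∑[ c ← allFin m ] ∑[ l ← range1 (k * m) ] ⟦ inverts i c l ⟧
          ≡⟨ sumL-allFin-suc (λ c → ∑[ l ← range1 (k * m) ] ⟦ inverts i c l ⟧) ⟩
        ∑[ l ← range1 (k * m) ] ⟦ inverts i Fin.zero l ⟧ + ∑[ c ← allFin m′ ] ∑[ l ← range1 (k * m) ] 0
          ≡⟨ cong (∑[ l ← range1 (k * m) ] ⟦ inverts i Fin.zero l ⟧ +_)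
                  (sumL-zero (λ _ → sumL-zero (λ _ → refl) (range1 (k * m))) (allFin m′)) ⟩
        ∑[ l ← range1 (k * m) ] ⟦ inverts i Fin.zero l ⟧ + 0
          ≡⟨ +-identityʳ _ ⟩
        ∑[ l ← range1 (k * m) ] ⟦ inverts i Fin.zero l ⟧
          ∎

  occupied? : ∀ {n} (V : Labelling n) j → Dec (Occupied V j)
  occupied? V j = any? λ i → any? λ c → V i c ≟ j

  bounded⇒unoccupied : ∀ {n} {V : Labelling n} {K} → (∀ i c → V i c ≤ K) → ∀ {j} → K ≤ j → ∀ i c → V i c ≢ suc j
  bounded⇒unoccupied V≤K K≤j i c Vic≡ = <⇒≱ (s≤s K≤j) (subst (_≤ _) Vic≡ (V≤K i c))

  minb-≤ : ∀ {n} (V : Labelling n) j → Std.minb V j ≤ n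
  minb-≤ V zero    = z≤n
  minb-≤ V (suc j) = first-≤ _ base 0 (allFin _) z≤n toℕ<n

  base-inject₁ : ∀ {n} (i : Fin n) → base (inject₁ i) ≡ base i
  base-inject₁ i = cong suc (toℕ-inject₁ i)

  base-fromℕ : ∀ n → base (fromℕ n) ≡ suc n
  base-fromℕ n = cong suc (toℕ-fromℕ n)

  module _ {n} (V : Labelling n) (r : Row) where

    private
      module V = Std V
      module W = Std (V ∷ʳ r)

    ∷ʳ-inject₁ᵛ : ∀ i c → (V ∷ʳ r) (inject₁ i) c ≡ V i c
    ∷ʳ-inject₁ᵛ i c = cong (λ row → row c) (∷ʳ-inject₁ V r i)

    ∷ʳ-fromℕᵛ : ∀ c → (V ∷ʳ r) (fromℕ n) c ≡ r c
    ∷ʳ-fromℕᵛ c = cong (λ row → row c) (∷ʳ-fromℕ V r)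

    minb-∷ʳ : ∀ j → W.minb (suc j) ≡
      first (λ i → V.baseIn i (suc j)) base (if W.baseIn (fromℕ n) (suc j) then suc n else 0) (allFin n)
    minb-∷ʳ j = trans (foldr-allFin-last (λ i rest → if W.baseIn i (suc j) then base i else rest) 0)
                      (foldr-cong step≗ default≡ (allFin n))
      where
      step≗ : ∀ i rest → (if W.baseIn (inject₁ i) (suc j) then base (inject₁ i) else rest)
                       ≡ (if V.baseIn i (suc j) then base i else rest)
      step≗ i rest = cong₂ (λ b x → if b then x else rest)
        (any-cong (λ c → cong (_≡ᵇ suc j) (∷ʳ-inject₁ᵛ i c)) (allFin m)) (base-inject₁ i)
      default≡ : (if W.baseIn (fromℕ n) (suc j) then base (fromℕ n) else 0)
               ≡ (if W.baseIn (fromℕ n) (suc j) then suc n else 0)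
      default≡ = cong (λ x → if W.baseIn (fromℕ n) (suc j) then x else 0) (base-fromℕ n)

    minb-∷ʳ-occupied : ∀ {j} → Occupied V (suc j) → W.minb (suc j) ≡ V.minb (suc j)
    minb-∷ʳ-occupied {j} (i , c , Vic≡) = trans (minb-∷ʳ j)
      (first-default _ base _ 0 (Any.tabulate⁺ i (any-allFin⁺ _ c (≡ᵇ-true⁺ Vic≡))))

    minb-∷ʳ-fresh : ∀ {j c} → (∀ i c → V i c ≢ suc j) → r c ≡ suc j → W.minb (suc j) ≡ suc n
    minb-∷ʳ-fresh {j} {c} unoccupied rc≡ = begin
      W.minb (suc j)
        ≡⟨ minb-∷ʳ j ⟩
      first _ base (if W.baseIn (fromℕ n) (suc j) then suc n else 0) (allFin n)
        ≡⟨ first-none _ base _ (All.tabulate⁺ absent) ⟩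
      (if W.baseIn (fromℕ n) (suc j) then suc n else 0)
        ≡⟨ cong (λ b → if b then suc n else 0) present ⟩
      suc n
        ∎
      where
      open ≡-Reasoning
      absent : ∀ i → V.baseIn i (suc j) ≡ false
      absent i = false⁺ λ found →
        let c′ , Vic′≡ = any-allFin⁻ _ (true⁺ found) in unoccupied i c′ (≡ᵇ-true⁻ Vic′≡)
      present : W.baseIn (fromℕ n) (suc j) ≡ true
      present = any-allFin⁺ _ c (≡ᵇ-true⁺ (trans (∷ʳ-fromℕᵛ c) rc≡))

    minb-∷ʳ-below : ∀ {K} → (∀ j → j < K → Occupied V (suc j)) → ∀ x → x ≤ K → W.minb x ≡ V.minb x
    minb-∷ʳ-below occupied zero    _   = refl
    minb-∷ʳ-below occupied (suc j) j<K = minb-∷ʳ-occupied (occupied j j<K)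

  module _ {n} {V : Labelling n} {r : Row} where

    private
      module V = Std V
      module W = Std (V ∷ʳ r)

    ∷ʳ-rows : ∀ {P : Row → Set} → (∀ {r r′} → (∀ c → r c ≡ r′ c) → P r → P r′) →
              (∀ i → P (V i)) → P r → ∀ i → P ((V ∷ʳ r) i)
    ∷ʳ-rows resp PV Pr i with view i
    ... | ‵fromℕ     = resp (sym ∘ ∷ʳ-fromℕᵛ V r) Pr
    ... | ‵inject₁ i = resp (sym ∘ ∷ʳ-inject₁ᵛ V r i) (PV i)

    ∷ʳ-isStd : ∀ {k} → Canonical r → IsStd k V → IsStd k (V ∷ʳ r)
    ∷ʳ-isStd {k} r-canonical s = record
      { occupied   = λ j j<km → let i , c , Vic≡ = occupied j j<km in
                       inject₁ i , c , trans (∷ʳ-inject₁ᵛ V r i c) Vic≡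
      ; zeroClosed = ∷ʳ-rows ZeroClosed-resp zeroClosed (Canonical-zeroClosed r-canonical)
      ; rotating   = ∷ʳ-rows Rotating-resp rotating (Canonical-rotating k r-canonical)
      ; increasing = λ l l<k → subst₂ _<_ (sym (agree (l * m) (*-monoˡ-≤ m (<⇒≤ l<k))))
                                          (sym (agree (suc l * m) (*-monoˡ-≤ m l<k))) (increasing l l<k)
      ; coloured   = λ j j<km → let i , c , b≡ , c≡ , V≡ = coloured j j<km in
                       inject₁ i , c , trans (base-inject₁ i) (trans b≡ (sym (agree (suc j) j<km))) ,
                       c≡ , trans (∷ʳ-inject₁ᵛ V r i c) V≡
      }
      where
      open IsStd s
      agree = minb-∷ʳ-below V r occupied

    ∷ʳ-isStd-newGroup : ∀ {k′} → Canonical r → r Fin.zero ≡ suc k′ * m → (∀ i c → V i c ≤ k′ * m) →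
                        IsStd k′ V → IsStd (suc k′) (V ∷ʳ r)
    ∷ʳ-isStd-newGroup {k′} r-canonical r₀≡ V≤k′m s = record
      { occupied   = occupied′
      ; zeroClosed = ∷ʳ-rows ZeroClosed-resp zeroClosed (Canonical-zeroClosed r-canonical)
      ; rotating   = ∷ʳ-rows Rotating-resp (λ i → Rotating-suc (V≤k′m i) (rotating i))
                             (Canonical-rotating (suc k′) r-canonical)
      ; increasing = increasing′
      ; coloured   = coloured′
      }
      where
      open IsStd s
      agree = minb-∷ʳ-below V r occupied

      newBlock = Canonical-newBlock {k′ = k′} r-canonical r₀≡

      occupied′ : ∀ j → j < suc k′ * m → Occupied (V ∷ʳ r) (suc j)
      occupied′ j j< with <-suc*-split k′ j j<
      ... | inj₁ j<k′m = let i , c , Vic≡ = occupied j j<k′m in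
                           inject₁ i , c , trans (∷ʳ-inject₁ᵛ V r i c) Vic≡
      ... | inj₂ (u , u<m , refl) = let c , _ , rc≡ = newBlock u u<m in
                                      fromℕ n , c , trans (∷ʳ-fromℕᵛ V r c) rc≡

      increasing′ : ∀ l → l < suc k′ → W.minb (l * m) < W.minb (suc l * m)
      increasing′ l l<1+k′ with l <? k′
      ... | yes l<k′ = subst₂ _<_ (sym (agree (l * m) (*-monoˡ-≤ m (<⇒≤ l<k′))))
                                  (sym (agree (suc l * m) (*-monoˡ-≤ m l<k′))) (increasing l l<k′)
      ... | no  l≮k′ with ≤-antisym (≤-pred l<1+k′) (≮⇒≥ l≮k′)
      ... | refl = subst₂ _<_ (sym (agree (l * m) ≤-refl))
                              (sym (minb-∷ʳ-fresh V r (bounded⇒unoccupied V≤k′m (m≤n+m (l * m) m′)) r₀≡))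
                              (s≤s (minb-≤ V (l * m)))

      coloured′ : ∀ j → j < suc k′ * m →
                  ∃ λ i → ∃ λ c → base i ≡ W.minb (suc j) × toℕ c ≡ suc j % m × (V ∷ʳ r) i c ≡ suc j
      coloured′ j j< with <-suc*-split k′ j j<
      ... | inj₁ j<k′m = let i , c , b≡ , c≡ , V≡ = coloured j j<k′m in
                           inject₁ i , c , trans (base-inject₁ i) (trans b≡ (sym (agree (suc j) j<k′m))) ,
                           c≡ , trans (∷ʳ-inject₁ᵛ V r i c) V≡
      ... | inj₂ (u , u<m , refl) =
        let c , c≡ , rc≡ = newBlock u u<m
            fresh = minb-∷ʳ-fresh V r (bounded⇒unoccupied V≤k′m (m≤m+n (k′ * m) u)) rc≡
        in fromℕ n , c , trans (base-fromℕ n) (sym fresh) , c≡ , trans (∷ʳ-fromℕᵛ V r c) rc≡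

    NewGroup : ℕ → Set
    NewGroup k = ∃ λ k′ → k ≡ suc k′ × r Fin.zero ≡ k * m × (∀ i c → V i c ≤ k′ * m) × IsStd k′ V

    module _ {k} (V≤km : ∀ i c → V i c ≤ k * m) (s : IsStd k (V ∷ʳ r)) where

      open IsStd s

      zeroClosedᵛ : ∀ i → ZeroClosed (V i)
      zeroClosedᵛ i = ZeroClosed-resp (∷ʳ-inject₁ᵛ V r i) (zeroClosed (inject₁ i))

      rotatingᵛ : ∀ i → Rotating k (V i)
      rotatingᵛ i = Rotating-resp (∷ʳ-inject₁ᵛ V r i) (rotating (inject₁ i))

      ∷ʳ-isStd⁻-canonical : r Fin.zero ≤ k * m → Canonical r
      ∷ʳ-isStd⁻-canonical = canonical-unique k r (ZeroClosed-resp (∷ʳ-fromℕᵛ V r) (zeroClosed (fromℕ n)))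
                                                  (Rotating-resp (∷ʳ-fromℕᵛ V r) (rotating (fromℕ n)))

      ∷ʳ-isStd⁻-restrict : ∀ K → K ≤ k → (∀ j → j < K * m → Occupied V (suc j)) → IsStd K V
      ∷ʳ-isStd⁻-restrict K K≤k occupiedᵛ = record
        { occupied   = occupiedᵛ
        ; zeroClosed = zeroClosedᵛ
        ; rotating   = λ i → Rotating-≤ K≤k (rotatingᵛ i)
        ; increasing = λ l l<K → subst₂ _<_ (agree (l * m) (*-monoˡ-≤ m (<⇒≤ l<K)))
                                            (agree (suc l * m) (*-monoˡ-≤ m l<K)) (increasing l (<-≤-trans l<K K≤k))
        ; coloured   = coloured′
        }
        where
        agree = minb-∷ʳ-below V r occupiedᵛ
        Km≤km = *-monoˡ-≤ m K≤k
        coloured′ : ∀ j → j < K * m →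
                    ∃ λ i → ∃ λ c → base i ≡ V.minb (suc j) × toℕ c ≡ suc j % m × V i c ≡ suc j
        coloured′ j j<Km with coloured j (<-≤-trans j<Km Km≤km)
        ... | i , c , b≡ , c≡ , W≡ with view i
        ... | ‵inject₁ i = i , c , trans (sym (base-inject₁ i)) (trans b≡ (agree (suc j) j<Km)) ,
                           c≡ , trans (sym (∷ʳ-inject₁ᵛ V r i c)) W≡
        ... | ‵fromℕ    = contradiction (minb-≤ V (suc j))
                            (<⇒≱ (subst (n <_) (trans (sym (base-fromℕ n)) (trans b≡ (agree (suc j) j<Km))) ≤-refl))

      -- A block missing from V takes its whole group with it (by rotation), so that group is
      -- filled by the last base alone; its least base is then the largest one, so by the
      -- ordering of the s_{lm} it must be the last group.
      private
        module Gap (j₀ : ℕ) (j₀<km : j₀ < k * m) (gap : ∀ i c → V i c ≢ suc j₀) where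

          l₀ = j₀ / m

          l₀<k : l₀ < k
          l₀<k = m<n*o⇒m/o<n {j₀} {k} {m} j₀<km

          group-empty : ∀ u → u < m → ∀ i c → V i c ≢ l₀ * m + 1 + u
          group-empty u u<m i c Vic≡ =
            let c′ , Vic′≡ = rotating-first (rotatingᵛ i) l₀<k u<m Vic≡
                c″ , Vic″≡ = rotating-shift (rotatingᵛ i) {t = j₀ % m} l₀<k (m%n<n j₀ m) Vic′≡
            in gap i c″ (trans Vic″≡ (trans (m+1+n≡1+m+n (l₀ * m) (j₀ % m))
                                           (cong suc (sym (j≡[j/m]*m+j%m j₀)))))

          top : ℕ
          top = l₀ * m + m′

          1+top≡ : suc l₀ * m ≡ suc top
          1+top≡ = cong suc (+-comm m′ (l₀ * m))

          top-unoccupied : ∀ i c → V i c ≢ suc top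
          top-unoccupied i c Vic≡ = group-empty m′ ≤-refl i c (trans Vic≡ (sym (m+1+n≡1+m+n (l₀ * m) m′)))

          top-in-r : ∃ λ c → toℕ c ≡ suc top % m × r c ≡ suc top
          top-in-r with coloured top (subst (_≤ k * m) 1+top≡ (*-monoˡ-≤ m l₀<k))
          ... | i , c , _ , c≡ , W≡ with view i
          ... | ‵inject₁ i = contradiction (trans (sym (∷ʳ-inject₁ᵛ V r i c)) W≡) (top-unoccupied i c)
          ... | ‵fromℕ    = c , c≡ , trans (sym (∷ʳ-fromℕᵛ V r c)) W≡

          k≡1+l₀ : k ≡ suc l₀
          k≡1+l₀ with suc l₀ <? k
          ... | no  1+l₀≮k = ≤-antisym (≮⇒≥ 1+l₀≮k) l₀<k
          ... | yes 1+l₀<k = contradiction (minb-≤ (V ∷ʳ r) (suc (suc l₀) * m)) (<⇒≱ (subst (_< W.minb (suc (suc l₀) * m))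
            (trans (cong W.minb 1+top≡) (minb-∷ʳ-fresh V r top-unoccupied (proj₂ (proj₂ top-in-r))))
            (increasing (suc l₀) 1+l₀<k)))

          r₀≡km : r Fin.zero ≡ k * m
          r₀≡km with top-in-r
          ... | Fin.zero  , _  , r≡ = trans r≡ (trans (sym 1+top≡) (cong (_* m) (sym k≡1+l₀)))
          ... | Fin.suc c , c≡ , _  =
            contradiction (trans c≡ (trans (cong (_% m) (sym 1+top≡)) (m*n%n≡0 (suc l₀) m))) λ ()

          V≤l₀m : ∀ i c → V i c ≤ l₀ * m
          V≤l₀m i c with V i c ≤? l₀ * m
          ... | yes V≤ = V≤
          ... | no  V≰ = contradiction Vic≡ (group-empty u u<m i c)
            where
            l₀m<V = ≰⇒> V≰
            u = V i c ∸ suc (l₀ * m)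
            Vic≡ : V i c ≡ l₀ * m + 1 + u
            Vic≡ = trans (sym (m+[n∸m]≡n l₀m<V)) (sym (m+1+n≡1+m+n (l₀ * m) u))
            u<m : u < m
            u<m = +-cancelˡ-< (suc (l₀ * m)) u m (subst (_< suc (l₀ * m) + m) (sym (m+[n∸m]≡n l₀m<V))
                    (s≤s (subst (V i c ≤_) (trans (cong (_* m) k≡1+l₀) (+-comm m (l₀ * m))) (V≤km i c))))

      ∷ʳ-isStd⁻-cases : IsStd k V ⊎ NewGroup k
      ∷ʳ-isStd⁻-cases with anyUpTo? (λ j → ¬? (occupied? V (suc j))) (k * m)
      ... | no  noGap = inj₁ (∷ʳ-isStd⁻-restrict k ≤-refl λ j j<km →
                          decidable-stable (occupied? V (suc j)) λ ¬occupied → noGap (j , j<km , ¬occupied))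
      ... | yes (j₀ , j₀<km , gap₀) =
        inj₂ (l₀ , k≡1+l₀ , r₀≡km , V≤l₀m , ∷ʳ-isStd⁻-restrict l₀ (<⇒≤ l₀<k) occupied-below)
        where
        unpack : ∀ {j} → ¬ Occupied V (suc j) → ∀ i c → V i c ≢ suc j
        unpack ¬occupied i c Vic≡ = ¬occupied (i , c , Vic≡)
        open Gap j₀ j₀<km (unpack gap₀)
        occupied-below : ∀ j → j < l₀ * m → Occupied V (suc j)
        occupied-below j j<l₀m = decidable-stable (occupied? V (suc j)) λ ¬occupied →
          <-irrefl (suc-injective (trans (sym (Gap.k≡1+l₀ j j<km (unpack ¬occupied))) k≡1+l₀))
                   (m<n*o⇒m/o<n {j} {l₀} {m} j<l₀m)
          where j<km = <-≤-trans j<l₀m (*-monoˡ-≤ m (<⇒≤ l₀<k))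

  module _ {n} (V : Labelling n) (r : Row) where

    private
      module V = Std V
      module W = Std (V ∷ʳ r)

    inversions-∷ʳ-split : ∀ k → W.inversions k ≡
      ∑[ i ← allFin n ] W.inversionsAt k (inject₁ i) + W.inversionsAt k (fromℕ n)
    inversions-∷ʳ-split k = sumL-allFin-last (W.inversionsAt k)

    inversionsAt-fromℕ : ∀ k → W.inversionsAt k (fromℕ n) ≡ ∑[ x < k * m ] ⟦ r Fin.zero <ᵇ suc x ⟧
    inversionsAt-fromℕ k = sumBelow-cong (k * m) λ x _ → cong ⟦_⟧ (begin
      ((V ∷ʳ r) (fromℕ n) Fin.zero <ᵇ suc x) ∧ not (base (fromℕ n) <ᵇ W.minb (suc x))
        ≡⟨ cong₂ (λ a b → (a <ᵇ suc x) ∧ not b) (∷ʳ-fromℕᵛ V r Fin.zero) (<ᵇ-false⁺ (last-not-before x)) ⟩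
      (r Fin.zero <ᵇ suc x) ∧ true
        ≡⟨ ∧-identityʳ _ ⟩
      r Fin.zero <ᵇ suc x ∎)
      where
      open ≡-Reasoning
      last-not-before : ∀ x → ¬ base (fromℕ n) < W.minb (suc x)
      last-not-before x lt = <⇒≱ lt (subst (W.minb (suc x) ≤_) (sym (base-fromℕ n)) (minb-≤ (V ∷ʳ r) (suc x)))

    inversionsAt-inject₁ : ∀ i K → (∀ j → j < K → Occupied V (suc j)) →
      ∑[ x < K ] ⟦ ((V ∷ʳ r) (inject₁ i) Fin.zero <ᵇ suc x) ∧ not (base (inject₁ i) <ᵇ W.minb (suc x)) ⟧
      ≡ ∑[ x < K ] ⟦ (V i Fin.zero <ᵇ suc x) ∧ not (base i <ᵇ V.minb (suc x)) ⟧
    inversionsAt-inject₁ i K occupied = sumBelow-cong K λ x x<K →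
      cong₂ (λ a b → ⟦ (a <ᵇ suc x) ∧ not b ⟧) (∷ʳ-inject₁ᵛ V r i Fin.zero)
            (cong₂ _<ᵇ_ (base-inject₁ i) (minb-∷ʳ-occupied V r (occupied x x<K)))

    inversions-∷ʳ : ∀ k → (∀ j → j < k * m → Occupied V (suc j)) →
                    W.inversions k ≡ V.inversions k + (k * m ∸ r Fin.zero)
    inversions-∷ʳ k occupied = begin
      W.inversions k
        ≡⟨ inversions-∷ʳ-split k ⟩
      ∑[ i ← allFin n ] W.inversionsAt k (inject₁ i) + W.inversionsAt k (fromℕ n)
        ≡⟨ cong₂ _+_ (sumL-cong (λ i → inversionsAt-inject₁ i (k * m) occupied) (allFin n))
                     (trans (inversionsAt-fromℕ k) (sumBelow-count-above (r Fin.zero) (k * m))) ⟩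
      V.inversions k + (k * m ∸ r Fin.zero)
        ∎
      where open ≡-Reasoning

    inversions-∷ʳ-newGroup : ∀ k′ → (∀ j → j < k′ * m → Occupied V (suc j)) → (∀ i c → V i c ≤ k′ * m) →
                             Canonical r → r Fin.zero ≡ suc k′ * m → W.inversions (suc k′) ≡ V.inversions k′
    inversions-∷ʳ-newGroup k′ occupied V≤k′m r-canonical r₀≡ = begin
      W.inversions (suc k′)
        ≡⟨ inversions-∷ʳ-split (suc k′) ⟩
      ∑[ i ← allFin n ] W.inversionsAt (suc k′) (inject₁ i) + W.inversionsAt (suc k′) (fromℕ n)
        ≡⟨ cong₂ _+_ (sumL-cong old-bases (allFin n)) last-base ⟩
      V.inversions k′ + 0
        ≡⟨ +-identityʳ _ ⟩
      V.inversions k′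
        ∎
      where
      open ≡-Reasoning
      term : Fin n → ℕ → ℕ
      term i x = ⟦ ((V ∷ʳ r) (inject₁ i) Fin.zero <ᵇ suc x) ∧ not (base (inject₁ i) <ᵇ W.minb (suc x)) ⟧
      new-group-free : ∀ i u → u < m → term i (k′ * m + u) ≡ 0
      new-group-free i u u<m = cong ⟦_⟧ (trans (cong (λ b → a ∧ not b) (<ᵇ-true⁺ i<minb)) (∧-zeroʳ a))
        where
        a = (V ∷ʳ r) (inject₁ i) Fin.zero <ᵇ suc (k′ * m + u)
        minb≡ : W.minb (suc (k′ * m + u)) ≡ suc n
        minb≡ = minb-∷ʳ-fresh V r (bounded⇒unoccupied V≤k′m (m≤m+n (k′ * m) u))
                  (proj₂ (proj₂ (Canonical-newBlock {k′ = k′} r-canonical r₀≡ u u<m)))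
        i<minb : base (inject₁ i) < W.minb (suc (k′ * m + u))
        i<minb = subst₂ _<_ (sym (base-inject₁ i)) (sym minb≡) (s≤s (toℕ<n i))
      old-bases : ∀ i → W.inversionsAt (suc k′) (inject₁ i) ≡ V.inversionsAt k′ i
      old-bases i = begin
        ∑[ x < suc k′ * m ] term i x
          ≡⟨ cong (λ K → sumBelow K (term i)) (+-comm m (k′ * m)) ⟩
        ∑[ x < k′ * m + m ] term i x
          ≡⟨ sumBelow-+ (term i) (k′ * m) m ⟩
        ∑[ x < k′ * m ] term i x + ∑[ u < m ] term i (k′ * m + u)
          ≡⟨ cong₂ _+_ (inversionsAt-inject₁ i (k′ * m) occupied) (sumBelow-zero m (λ u → new-group-free i u)) ⟩
        V.inversionsAt k′ i + 0
          ≡⟨ +-identityʳ _ ⟩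
        V.inversionsAt k′ i
          ∎
      last-base : W.inversionsAt (suc k′) (fromℕ n) ≡ 0
      last-base = begin
        W.inversionsAt (suc k′) (fromℕ n)               ≡⟨ inversionsAt-fromℕ (suc k′) ⟩
        ∑[ x < suc k′ * m ] ⟦ r Fin.zero <ᵇ suc x ⟧     ≡⟨ sumBelow-count-above (r Fin.zero) (suc k′ * m) ⟩
        suc k′ * m ∸ r Fin.zero                         ≡⟨ cong (suc k′ * m ∸_) r₀≡ ⟩
        suc k′ * m ∸ suc k′ * m                         ≡⟨ n∸n≡0 (suc k′ * m) ⟩
        0                                               ∎

  standardWith : ∀ {n} → ℕ → ℕ → Labelling n → Bool
  standardWith k d V = Std.isStd V k ∧ (Std.inversions V k ≡ᵇ d)

  boundedᵇ : ∀ {n} → ℕ → Labelling n → Bool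
  boundedᵇ K V = allᵛ λ i → allᵛ λ c → V i c <ᵇ K * m + 1

  canonicalᵇ : Row → Bool
  canonicalᵇ r = allᵛ λ c → r c ≡ᵇ canonical (r Fin.zero) c

  sameGroups : ∀ {n} → ℕ → ℕ → Labelling n → ℕ → ℕ
  sameGroups k d V j = ⟦ Std.isStd V k ∧ (Std.inversions V k + (k * m ∸ j) ≡ᵇ d) ⟧

  newGroup : ∀ {n} → ℕ → ℕ → Labelling n → ℕ → ℕ
  newGroup zero     d V j = 0
  newGroup (suc k′) d V j = ⟦ (j ≡ᵇ suc k′ * m) ∧ boundedᵇ k′ V ∧ standardWith k′ d V ⟧

  bounded⁻ : ∀ {n} K (V : Labelling n) → boundedᵇ K V ≡ true → ∀ i c → V i c ≤ K * m
  bounded⁻ K V h i c = ≤-pred (subst (V i c <_) (+-comm (K * m) 1)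
    (<ᵇ-true⁻ (allᵛ⁻ (λ c → V i c <ᵇ K * m + 1) (allᵛ⁻ (λ i → allᵛ λ c → V i c <ᵇ K * m + 1) h i) c)))

  bounded⁺ : ∀ {n} K (V : Labelling n) → (∀ i c → V i c ≤ K * m) → boundedᵇ K V ≡ true
  bounded⁺ K V V≤ = allᵛ⁺ _ λ i → allᵛ⁺ _ λ c →
    <ᵇ-true⁺ (subst (V i c <_) (+-comm 1 (K * m)) (s≤s (V≤ i c)))

  canonical⁻ : ∀ r → canonicalᵇ r ≡ true → Canonical r
  canonical⁻ r h c = ≡ᵇ-true⁻ (allᵛ⁻ (λ c → r c ≡ᵇ canonical (r Fin.zero) c) h c)

  canonical⁺ : ∀ r → Canonical r → canonicalᵇ r ≡ true
  canonical⁺ r r≗ = allᵛ⁺ _ (≡ᵇ-true⁺ ∘ r≗)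

  isStd-suc-unbounded : ∀ {n k′} {V : Labelling n} → IsStd (suc k′) V → ¬ (∀ i c → V i c ≤ k′ * m)
  isStd-suc-unbounded {k′ = k′} s V≤k′m =
    let i , c , Vic≡ = IsStd.occupied s (m′ + k′ * m) ≤-refl in
    bounded⇒unoccupied V≤k′m (m≤n+m (k′ * m) m′) i c Vic≡

  newGroup-isStd : ∀ {n} k d (V : Labelling n) j → IsStd k V → newGroup k d V j ≡ 0
  newGroup-isStd zero     d V j s = refl
  newGroup-isStd (suc k′) d V j s with boundedᵇ k′ V in bounded
  ... | true  = contradiction (bounded⁻ k′ V bounded) (isStd-suc-unbounded s)
  ... | false = cong ⟦_⟧ (∧-zeroʳ (j ≡ᵇ suc k′ * m))

  newGroup-∷ʳ : ∀ {n} k d (V : Labelling n) r → Canonical r → Std.isStd (V ∷ʳ r) k ≡ false →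
                newGroup k d V (r Fin.zero) ≡ 0
  newGroup-∷ʳ zero     d V r r-canonical notStd = refl
  newGroup-∷ʳ (suc k′) d V r r-canonical notStd
    with r Fin.zero ≡ᵇ suc k′ * m in r₀≡ | boundedᵇ k′ V in bounded | Std.isStd V k′ in isStdV
  ... | false | _     | _     = refl
  ... | true  | false | _     = refl
  ... | true  | true  | false = refl
  ... | true  | true  | true  = contradiction (trans (sym isStdW) notStd) λ ()
    where
    isStdW = isStd⁺ _ (suc k′)
      (∷ʳ-isStd-newGroup r-canonical (≡ᵇ-true⁻ r₀≡) (bounded⁻ k′ V bounded) (isStd⁻ V k′ isStdV))

  standardWith-∷ʳ : ∀ {n k} d (V : Labelling n) r → (∀ i c → V i c ≤ k * m) → r Fin.zero ≤ k * m →
    ⟦ standardWith k d (V ∷ʳ r) ⟧ ≡ ⟦ canonicalᵇ r ⟧ * (sameGroups k d V (r Fin.zero) + newGroup k d V (r Fin.zero))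
  standardWith-∷ʳ {n} {k} d V r V≤km r₀≤km with Std.isStd (V ∷ʳ r) k in isStdW
  ... | true
    with ∷ʳ-isStd⁻-cases V≤km (isStd⁻ _ k isStdW)
       | canonical⁺ r (∷ʳ-isStd⁻-canonical V≤km (isStd⁻ _ k isStdW) r₀≤km)
  ... | inj₁ sV | canonical
    rewrite canonical | isStd⁺ V k sV | newGroup-isStd k d V (r Fin.zero) sV
          | inversions-∷ʳ V r k (IsStd.occupied sV)
    = sym (trans (*-identityˡ _) (+-identityʳ _))
  ... | inj₂ (k′ , refl , r₀≡ , V≤k′m , sV) | canonical
    rewrite canonical | false⁺ (λ isStdV → isStd-suc-unbounded (isStd⁻ V (suc k′) (true⁺ isStdV)) V≤k′m)
          | ≡ᵇ-true⁺ r₀≡ | bounded⁺ k′ V V≤k′m | isStd⁺ V k′ sV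
          | inversions-∷ʳ-newGroup V r k′ (IsStd.occupied sV) V≤k′m (canonical⁻ r canonical) r₀≡
    = sym (*-identityˡ _)
  standardWith-∷ʳ {n} {k} d V r V≤km r₀≤km | false with canonicalᵇ r in canonical
  ... | false = refl
  ... | true with Std.isStd V k in isStdV
  ...   | true  = contradiction
    (trans (sym (isStd⁺ _ k (∷ʳ-isStd (canonical⁻ r canonical) (isStd⁻ V k isStdV)))) isStdW) λ ()
  ...   | false = sym (trans (+-identityʳ _) (newGroup-∷ʳ k d V r (canonical⁻ r canonical) isStdW))

  FinRow : ℕ → Set
  FinRow k = Fin m → Fin (k * m + 1)

  rows : ∀ k → List (FinRow k)
  rows k = allFuns (allFin (k * m + 1)) m

  labellings : ∀ n k → List (Fin n → FinRow k)
  labellings n k = allFuns (rows k) n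

  S≡∑ : ∀ n k d → Partition.Scoeff m n k d ≡ ∑[ L ← labellings n k ] ⟦ standardWith k d (toℕ-labels L) ⟧
  S≡∑ n k d = trans (count≡∑ _ (labellings n k)) (sumL-cong (λ L →
    cong₂ (λ s i → ⟦ s ∧ (i ≡ᵇ d) ⟧) (isStd-toℕ {k = k} L) (inv-toℕ {k = k} L)) (labellings n k))

  standardWith-cong : ∀ {n} k d {V W : Labelling n} → V ≗₂ W → standardWith k d V ≡ standardWith k d W
  standardWith-cong k d V≗W = cong₂ (λ s i → s ∧ (i ≡ᵇ d)) (isStd-cong V≗W k) (inversions-cong V≗W k)

  toℕ-labels-∷ʳ : ∀ {n B} (L : Fin n → Fin m → Fin B) ρ → toℕ-labels (L ∷ʳ ρ) ≗₂ (toℕ-labels L ∷ʳ (toℕ ∘ ρ))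
  toℕ-labels-∷ʳ {zero}  L ρ i           c = refl
  toℕ-labels-∷ʳ {suc n} L ρ Fin.zero    c = refl
  toℕ-labels-∷ʳ {suc n} L ρ (Fin.suc i) c = toℕ-labels-∷ʳ (L ∘ Fin.suc) ρ i c

  label≤ : ∀ k (x : Fin (k * m + 1)) → toℕ x ≤ k * m
  label≤ k x = ≤-pred (subst (toℕ x <_) (+-comm (k * m) 1) (toℕ<n x))

  contribution : ∀ {n} → ℕ → ℕ → Labelling n → ℕ → ℕ
  contribution k d V j = sameGroups k d V j + newGroup k d V j

  S-suc≡∑ : ∀ n k d → Partition.Scoeff m (suc n) k d ≡
    ∑[ L ← labellings n k ] ∑[ ρ ← rows k ] ⟦ canonicalᵇ (toℕ ∘ ρ) ⟧ * contribution k d (toℕ-labels L) (toℕ (ρ Fin.zero))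
  S-suc≡∑ n k d = begin
    Partition.Scoeff m (suc n) k d
      ≡⟨ S≡∑ (suc n) k d ⟩
    ∑[ L ← labellings (suc n) k ] ⟦ standardWith k d (toℕ-labels L) ⟧
      ≡⟨ sumL-allFuns-∷ʳ (rows k) n _ (λ L L′ L≗L′ →
           cong ⟦_⟧ (standardWith-cong k d λ i c → cong (λ ρ → toℕ (ρ c)) (L≗L′ i))) ⟩
    ∑[ L ← labellings n k ] ∑[ ρ ← rows k ] ⟦ standardWith k d (toℕ-labels (L ∷ʳ ρ)) ⟧
      ≡⟨ sumL-cong (λ L → sumL-cong (λ ρ → trans (cong ⟦_⟧ (standardWith-cong k d (toℕ-labels-∷ʳ L ρ)))
           (standardWith-∷ʳ {k = k} d (toℕ-labels L) (toℕ ∘ ρ) (λ i c → label≤ k (L i c)) (label≤ k (ρ Fin.zero))))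
           (rows k)) (labellings n k) ⟩
    ∑[ L ← labellings n k ] ∑[ ρ ← rows k ] ⟦ canonicalᵇ (toℕ ∘ ρ) ⟧ * contribution k d (toℕ-labels L) (toℕ (ρ Fin.zero))
      ∎
    where open ≡-Reasoning

  ∑-canonicalRows : ∀ k (K : ℕ → ℕ) →
    ∑[ ρ ← rows k ] ⟦ canonicalᵇ (toℕ ∘ ρ) ⟧ * K (toℕ (ρ Fin.zero)) ≡ ∑[ j ← allFin (k * m + 1) ] K (toℕ j)
  ∑-canonicalRows k K = begin
    ∑[ ρ ← rows k ] ⟦ canonicalᵇ (toℕ ∘ ρ) ⟧ * K (toℕ (ρ Fin.zero))
      ≡⟨ sumL-allFuns-suc labels m′ _ ⟩
    ∑[ f ← allFuns labels m′ ] ∑[ x ← labels ] ⟦ (toℕ x ≡ᵇ canonical (toℕ x) Fin.zero) ∧ follows x f ⟧ * K (toℕ x)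
      ≡⟨ sumL-cong (λ f → sumL-cong (λ x → cong (λ b → ⟦ b ∧ follows x f ⟧ * K (toℕ x))
           (≡ᵇ-true⁺ (sym (canonical-zero (toℕ x))))) labels) (allFuns labels m′) ⟩
    ∑[ f ← allFuns labels m′ ] ∑[ x ← labels ] ⟦ follows x f ⟧ * K (toℕ x)
      ≡⟨ sumL-swap (λ f x → ⟦ follows x f ⟧ * K (toℕ x)) (allFuns labels m′) labels ⟩
    ∑[ x ← labels ] ∑[ f ← allFuns labels m′ ] ⟦ follows x f ⟧ * K (toℕ x)
      ≡⟨ sumL-cong (λ x → unique-follower x) labels ⟩
    ∑[ x ← labels ] K (toℕ x)
      ∎
    where
    open ≡-Reasoning
    labels = allFin (k * m + 1)
    follows : Fin (k * m + 1) → (Fin m′ → Fin (k * m + 1)) → Bool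
    follows x f = allᵛ (λ c → toℕ (f c) ≡ᵇ canonical (toℕ x) (Fin.suc c))
    unique-follower : ∀ x → ∑[ f ← allFuns labels m′ ] ⟦ follows x f ⟧ * K (toℕ x) ≡ K (toℕ x)
    unique-follower x = begin
      ∑[ f ← allFuns labels m′ ] ⟦ follows x f ⟧ * K (toℕ x)
        ≡⟨ sumL-cong (λ f → *-comm ⟦ follows x f ⟧ (K (toℕ x))) (allFuns labels m′) ⟩
      ∑[ f ← allFuns labels m′ ] K (toℕ x) * ⟦ follows x f ⟧
        ≡⟨ sumL-*ˡ (K (toℕ x)) _ (allFuns labels m′) ⟩
      K (toℕ x) * (∑[ f ← allFuns labels m′ ] ⟦ follows x f ⟧)
        ≡⟨ cong (K (toℕ x) *_) (sumL-allFuns-graph (k * m + 1) m′ _ canonical<) ⟩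
      K (toℕ x) * 1
        ≡⟨ *-identityʳ _ ⟩
      K (toℕ x)
        ∎
      where
      canonical< : ∀ c → canonical (toℕ x) (Fin.suc c) < k * m + 1
      canonical< c = subst (canonical (toℕ x) (Fin.suc c) <_) (+-comm 1 (k * m))
                           (s≤s (canonical-≤ k (toℕ x) (Fin.suc c) (label≤ k x)))

  +≡ᵇ : ∀ i e d → (i + e ≡ᵇ d) ≡ (e <ᵇ suc d) ∧ (i ≡ᵇ d ∸ e)
  +≡ᵇ i e d with e ≤? d
  ... | yes e≤d rewrite <ᵇ-true⁺ (s≤s e≤d) =
    ≡ᵇ-cong⁺ (mk⇔ (λ i+e≡d → trans (sym (m+n∸n≡m i e)) (cong (_∸ e) i+e≡d))
                  (λ i≡d∸e → trans (cong (_+ e) i≡d∸e) (m∸n+n≡m e≤d)))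
  ... | no  e≰d rewrite <ᵇ-false⁺ (e≰d ∘ ≤-pred) =
    false⁺ (λ i+e≡d → e≰d (subst (e ≤_) (≡ᵇ⇒≡ _ d i+e≡d) (m≤n+m e i)))

  ∑-sameGroups : ∀ n k d →
    ∑[ L ← labellings n k ] ∑[ j ← allFin (k * m + 1) ] sameGroups k d (toℕ-labels L) (toℕ j)
    ≡ sumTo d (λ i → qint (ℤ.+ (k * m + 1)) i * Partition.Scoeff m n k (d ∸ i))
  ∑-sameGroups n k d = begin
    ∑[ L ← labellings n k ] ∑[ j ← allFin (k * m + 1) ] sameGroups k d (toℕ-labels L) (toℕ j)
      ≡⟨ sumL-swap (λ L j → sameGroups k d (toℕ-labels L) (toℕ j)) (labellings n k) (allFin (k * m + 1)) ⟩
    ∑[ j ← allFin (k * m + 1) ] shifted (k * m ∸ toℕ j)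
      ≡⟨ sumL-allFin-toℕ (k * m + 1) (λ j → shifted (k * m ∸ j)) ⟩
    ∑[ j < k * m + 1 ] shifted (k * m ∸ j)
      ≡⟨ cong (λ K → sumBelow K (λ j → shifted (k * m ∸ j))) (+-comm (k * m) 1) ⟩
    ∑[ j < suc (k * m) ] shifted (k * m ∸ j)
      ≡⟨ sumBelow-reverse (k * m) shifted ⟩
    ∑[ e < suc (k * m) ] shifted e
      ≡⟨ sumBelow-cong (suc (k * m)) (λ e _ → shifted≡ e) ⟩
    ∑[ e < suc (k * m) ] ⟦ e <ᵇ suc d ⟧ * S (d ∸ e)
      ≡⟨ sumBelow-swap-bounds (suc (k * m)) (suc d) (λ e → S (d ∸ e)) ⟩
    ∑[ e < suc d ] ⟦ e <ᵇ suc (k * m) ⟧ * S (d ∸ e)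
      ≡⟨ sumBelow-cong (suc d) (λ e _ → cong (_* S (d ∸ e))
           (trans (⟦⟧≡if (e <ᵇ suc (k * m))) (cong (λ B → if e <ᵇ B then 1 else 0) (+-comm 1 (k * m))))) ⟩
    ∑[ e < suc d ] qint (ℤ.+ (k * m + 1)) e * S (d ∸ e)
      ≡⟨ sym (sumTo≡sumBelow d _) ⟩
    sumTo d (λ e → qint (ℤ.+ (k * m + 1)) e * S (d ∸ e))
      ∎
    where
    open ≡-Reasoning
    S = Partition.Scoeff m n k
    shifted : ℕ → ℕ
    shifted e = ∑[ L ← labellings n k ] ⟦ Std.isStd (toℕ-labels L) k ∧ (Std.inversions (toℕ-labels L) k + e ≡ᵇ d) ⟧
    shifted≡ : ∀ e → shifted e ≡ ⟦ e <ᵇ suc d ⟧ * S (d ∸ e)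
    shifted≡ e = begin
      shifted e
        ≡⟨ sumL-cong (λ L → trans (cong (λ b → ⟦ Std.isStd (toℕ-labels L) k ∧ b ⟧)
                                        (+≡ᵇ (Std.inversions (toℕ-labels L) k) e d))
                                  (⟦∧⟧-swap (Std.isStd (toℕ-labels L) k) (e <ᵇ suc d) _)) (labellings n k) ⟩
      ∑[ L ← labellings n k ] ⟦ e <ᵇ suc d ⟧ * ⟦ standardWith k (d ∸ e) (toℕ-labels L) ⟧
        ≡⟨ sumL-*ˡ ⟦ e <ᵇ suc d ⟧ _ (labellings n k) ⟩
      ⟦ e <ᵇ suc d ⟧ * (∑[ L ← labellings n k ] ⟦ standardWith k (d ∸ e) (toℕ-labels L) ⟧)
        ≡⟨ cong (⟦ e <ᵇ suc d ⟧ *_) (sym (S≡∑ n k (d ∸ e))) ⟩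
      ⟦ e <ᵇ suc d ⟧ * S (d ∸ e)
        ∎

  ∑-newGroup : ∀ n k d →
    ∑[ L ← labellings n k ] ∑[ j ← allFin (k * m + 1) ] newGroup k d (toℕ-labels L) (toℕ j)
    ≡ S[ m , n , ℤ.+ k ℤ.- ℤ.+ 1 ] d
  ∑-newGroup n zero     d = sumL-zero (λ L → sumL-zero (λ _ → refl) (allFin 1)) (labellings n 0)
  ∑-newGroup n (suc k′) d = begin
    ∑[ L ← labellings n (suc k′) ] ∑[ j ← allFin (suc k′ * m + 1) ] newGroup (suc k′) d (toℕ-labels L) (toℕ j)
      ≡⟨ sumL-cong only-top-label (labellings n (suc k′)) ⟩
    ∑[ L ← labellings n (suc k′) ] ⟦ boundedᵇ k′ (toℕ-labels L) ⟧ * H L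
      ≡⟨ sumL-allFuns-restrict (λ ρ ρ′ → ∀ c → ρ c ≡ ρ′ c) (λ _ _ → refl) restrictRow (λ ρ′ → inject ∘ ρ′)
           (rows (suc k′)) (rows k′) restrict-rows n H (λ L L′ L≈L′ → H-cong λ i c → cong toℕ (L≈L′ i c)) ⟩
    ∑[ L′ ← labellings n k′ ] H (λ i → inject ∘ L′ i)
      ≡⟨ sumL-cong (λ L′ → H-cong λ i c → toℕ-inject≤ (L′ i c) k′m+1≤) (labellings n k′) ⟩
    ∑[ L′ ← labellings n k′ ] ⟦ standardWith k′ d (toℕ-labels L′) ⟧
      ≡⟨ sym (S≡∑ n k′ d) ⟩
    Partition.Scoeff m n k′ d
      ∎
    where
    open ≡-Reasoning
    H : ∀ {B} → (Fin n → Fin m → Fin B) → ℕ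
    H L = ⟦ standardWith k′ d (toℕ-labels L) ⟧
    only-top-label : ∀ L → ∑[ j ← allFin (suc k′ * m + 1) ] newGroup (suc k′) d (toℕ-labels L) (toℕ j)
                           ≡ ⟦ boundedᵇ k′ (toℕ-labels L) ⟧ * H L
    only-top-label L = begin
      ∑[ j ← allFin (suc k′ * m + 1) ] ⟦ (toℕ j ≡ᵇ suc k′ * m) ∧ b ⟧
        ≡⟨ sumL-cong (λ j → trans (⟦∧⟧ (toℕ j ≡ᵇ suc k′ * m) b) (*-comm ⟦ toℕ j ≡ᵇ suc k′ * m ⟧ ⟦ b ⟧))
                     (allFin (suc k′ * m + 1)) ⟩
      ∑[ j ← allFin (suc k′ * m + 1) ] ⟦ b ⟧ * ⟦ toℕ j ≡ᵇ suc k′ * m ⟧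
        ≡⟨ sumL-*ˡ ⟦ b ⟧ _ (allFin (suc k′ * m + 1)) ⟩
      ⟦ b ⟧ * (∑[ j ← allFin (suc k′ * m + 1) ] ⟦ toℕ j ≡ᵇ suc k′ * m ⟧)
        ≡⟨ cong (⟦ b ⟧ *_) (sumL-allFin-≡ᵇ (suc k′ * m + 1) (suc k′ * m) (m<m+n _ z<s)) ⟩
      ⟦ b ⟧ * 1
        ≡⟨ *-identityʳ ⟦ b ⟧ ⟩
      ⟦ b ⟧
        ≡⟨ ⟦∧⟧ (boundedᵇ k′ (toℕ-labels L)) _ ⟩
      ⟦ boundedᵇ k′ (toℕ-labels L) ⟧ * H L
        ∎
      where b = boundedᵇ k′ (toℕ-labels L) ∧ standardWith k′ d (toℕ-labels L)
    H-cong : ∀ {B B′} {L : Fin n → Fin m → Fin B} {L′ : Fin n → Fin m → Fin B′} →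
             toℕ-labels L ≗₂ toℕ-labels L′ → H L ≡ H L′
    H-cong L≗L′ = cong ⟦_⟧ (standardWith-cong k′ d L≗L′)
    k′m+1≤ : k′ * m + 1 ≤ suc k′ * m + 1
    k′m+1≤ = +-monoˡ-≤ 1 (m≤n+m (k′ * m) m)
    inject : Fin (k′ * m + 1) → Fin (suc k′ * m + 1)
    inject x = inject≤ x k′m+1≤
    restrictRow : FinRow (suc k′) → Bool
    restrictRow ρ = allᵛ (λ c → toℕ (ρ c) <ᵇ k′ * m + 1)
    restrict-rows : ∀ h → (∀ ρ ρ′ → (∀ c → ρ c ≡ ρ′ c) → h ρ ≡ h ρ′) →
                    ∑[ ρ ← rows (suc k′) ] ⟦ restrictRow ρ ⟧ * h ρ ≡ ∑[ ρ′ ← rows k′ ] h (inject ∘ ρ′)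
    restrict-rows h h-resp = sumL-allFuns-restrict _≡_ (λ _ → refl) (λ x → toℕ x <ᵇ k′ * m + 1) inject
      (allFin (suc k′ * m + 1)) (allFin (k′ * m + 1)) (λ g _ → sumL-allFin-inject≤ k′m+1≤ g) m h
      (λ ρ ρ′ ρ≗ρ′ → h-resp ρ ρ′ ρ≗ρ′)

  S-suc : ∀ n k d → Partition.Scoeff m (suc n) k d ≡
    S[ m , n , ℤ.+ k ℤ.- ℤ.+ 1 ] d + sumTo d (λ i → qint (ℤ.+ (k * m + 1)) i * Partition.Scoeff m n k (d ∸ i))
  S-suc n k d = begin
    Partition.Scoeff m (suc n) k d
      ≡⟨ S-suc≡∑ n k d ⟩
    ∑[ L ← labellings n k ] ∑[ ρ ← rows k ] ⟦ canonicalᵇ (toℕ ∘ ρ) ⟧ * contribution k d (toℕ-labels L) (toℕ (ρ Fin.zero))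
      ≡⟨ sumL-cong (λ L → trans (∑-canonicalRows k (contribution k d (toℕ-labels L)))
                                (sumL-+ _ _ (allFin (k * m + 1)))) (labellings n k) ⟩
    ∑[ L ← labellings n k ] (∑[ j ← allFin (k * m + 1) ] sameGroups k d (toℕ-labels L) (toℕ j)
                            + ∑[ j ← allFin (k * m + 1) ] newGroup k d (toℕ-labels L) (toℕ j))
      ≡⟨ sumL-+ _ _ (labellings n k) ⟩
    sameTotal + newTotal
      ≡⟨ +-comm sameTotal newTotal ⟩
    newTotal + sameTotal
      ≡⟨ cong₂ _+_ (∑-newGroup n k d) (∑-sameGroups n k d) ⟩
    S[ m , n , ℤ.+ k ℤ.- ℤ.+ 1 ] d + sumTo d (λ i → qint (ℤ.+ (k * m + 1)) i * Partition.Scoeff m n k (d ∸ i))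
      ∎
    where
    open ≡-Reasoning
    sameTotal = ∑[ L ← labellings n k ] ∑[ j ← allFin (k * m + 1) ] sameGroups k d (toℕ-labels L) (toℕ j)
    newTotal = ∑[ L ← labellings n k ] ∑[ j ← allFin (k * m + 1) ] newGroup k d (toℕ-labels L) (toℕ j)

open import Defs
open import Data.Nat using (ℕ; suc; NonZero)
open import Data.Integer using (ℤ; +_; _-_; _*_; _+_)
open import Data.Product using (_×_)

import Data.Nat as ℕ
import Data.Nat.Properties as ℕ
open import Data.Integer using (-[1+_])
open import Data.Integer.Properties using (+◃n≡+n)
open import Data.Product using (_,_)
open import Relation.Binary.PropositionalEquality
open FiniteSums using (sumBelow-zero; sumTo≡sumBelow)

proposition3p1 : (m : ℕ) → {{_ : NonZero m}} →
    ((k : ℤ) → S[ m , 0 , k ] ≈ₚ δ₀ k)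
    × ((n : ℕ) → (k : ℤ) →
         S[ m , suc n , k ] ≈ₚ S[ m , n , k - + 1 ] ⊕ qint (k * + m + + 1) ⊛ S[ m , n , k ])
proposition3p1 (suc m′) = S-zero , S-suc
  where
  S-zero : ∀ k → S[ suc m′ , 0 , k ] ≈ₚ δ₀ k
  S-zero (+ 0)     0       = refl
  S-zero (+ 0)     (suc d) = refl
  S-zero (+ suc k) d       = refl
  S-zero -[1+ k ]  d       = refl
  S-suc : ∀ n k → S[ suc m′ , suc n , k ] ≈ₚ S[ suc m′ , n , k - + 1 ] ⊕ qint (k * + suc m′ + + 1) ⊛ S[ suc m′ , n , k ]
  S-suc n (+ k)    d = trans (ColouredPartitions.S-suc m′ n k d)
    (cong (λ z → S[ suc m′ , n , + k - + 1 ] d ℕ.+ sumTo d (λ i → qint (z + + 1) i ℕ.* S[ suc m′ , n , + k ] (d ℕ.∸ i)))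
          (sym (+◃n≡+n (k ℕ.* suc m′))))
  S-suc n -[1+ k ] d = sym (trans (sumTo≡sumBelow d _)
    (sumBelow-zero (suc d) λ i _ → ℕ.*-zeroʳ (qint (-[1+ k ] * + suc m′ + + 1) i)))
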